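{- Let $D=(E,\mathcal{F})$ be an even normal binary delta-matroid. Then the twist polynomial ${}^{\partial}w_{D}(z)$ is of the form $m z^{k}$ (a single term) if and only if every connected component of the intersection graph $G_D$ is a complete graph with an odd number of vertices.
   Context: A set system is a pair $D=(E,\mathcal{F})$ with $E$ a finite set and $\mathcal{F}$ a nonempty family of subsets of $E$. It is a delta-matroid if for all $X,Y\in\mathcal{F}$ and $u\in X\Delta Y$ there is $v\in X\Delta Y$ (possibly $v=u$) with $X\Delta\{u,v\}\in\mathcal{F}$. For $A\subseteq E$ the twist is $D*A=(E,\{A\Delta X: X\in\mathcal{F}\})$. The width $w(D)$ is the maximum cardinality of a feasible set minus the minimum cardinality of a feasible set. The twist polynomial is ${}^{\partial}w_{D}(z)=\sum_{A\subseteq E} z^{w(D*A)}$. $D$ is even if $|F\Delta F'|$ is even for all feasible $F,F'$. For a symmetric matrix $C$ over $GF(2)$ indexed by $E$, $D(C)=(E,\{A\subseteq E: C[A]\text{ nonsingular}\})$ ($C[A]$ the principal submatrix on $A$, $C[\emptyset]$ nonsingular by convention). A normal binary delta-matroid is one of the form $D=D(C)$; $C$ is uniquely determined by $D$. The intersection graph $G_D$ has vertex set $E$, distinct $u,v$ adjacent iff $C_{u,v}=1$, and a loop at $v$ iff $C_{v,v}=1$. -}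

module Defs where

open import Data.Nat using (ℕ; zero; suc; _⊔_; _⊓_; _∸_; _%_)
open import Data.Bool using (Bool; true; false; _∧_; _xor_; not; if_then_else_)
open import Data.Fin using (Fin)
open import Data.Vec using (Vec; []; _∷_; zipWith; lookup; tabulate)
open import Data.List using (List; []; _∷_; map; filter; length; foldr; _++_; allFin)
open import Data.Bool.ListAction using (all)
open import Data.Fin.Subset using (Subset; ∣_∣; _∈_; ⊥)
open import Relation.Binary.PropositionalEquality using (_≡_)
open import Relation.Nullary using (¬_)
open import Data.Nat using (_≟_)
open import Data.Product using (_×_; ∃)
open import Function.Bundles using (_⇔_)

-- A square matrix over GF(2) (GF(2) = Bool, + = xor, * = ∧) indexed by Fin n.
Matrix : ℕ → Set
Matrix n = Fin n → Fin n → Bool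

Symmetric : {n : ℕ} → Matrix n → Set
Symmetric {n} C = (u v : Fin n) → C u v ≡ C v u

allSubsets : (n : ℕ) → List (Subset n)
allSubsets zero = [] ∷ []
allSubsets (suc n) = map (false ∷_) (allSubsets n) ++ map (true ∷_) (allSubsets n)

_Δ_ : {n : ℕ} → Subset n → Subset n → Subset n
A Δ B = zipWith _xor_ A B

xorSum : {n : ℕ} → (Fin n → Bool) → Bool
xorSum {n} f = Data.Vec.foldr _ _xor_ false (tabulate f)

-- Row i of the product C[A] x, where x is a vector supported on A
-- (entries of x and indices j outside A are masked out).
rowProd : {n : ℕ} → Matrix n → Subset n → Subset n → Fin n → Bool
rowProd C A x i = xorSum (λ j → C i j ∧ (lookup A j ∧ lookup x j))

inKernel : {n : ℕ} → Matrix n → Subset n → Subset n → Bool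
inKernel {n} C A x =
  all (λ j → not (lookup x j) Data.Bool.∨ lookup A j) (allFin n)
  ∧ all (λ i → not (lookup A i) Data.Bool.∨ not (rowProd C A x i)) (allFin n)

isEmptyB : {n : ℕ} → Subset n → Bool
isEmptyB x = all (λ b → not b) (Data.Vec.toList x)

-- The principal submatrix C[A] is nonsingular over GF(2): its kernel is trivial,
-- i.e. the only vector supported in A with C[A] x = 0 is x = 0.
-- (For A = ∅ this holds, matching the convention that C[∅] is nonsingular.)
nonsingular : {n : ℕ} → Matrix n → Subset n → Bool
nonsingular {n} C A = all (λ x → not (inKernel C A x) Data.Bool.∨ isEmptyB x) (allSubsets n)

-- A set system on Fin n, given by the (duplicate-free) list of its feasible sets.
SetSystem : ℕ → Set
SetSystem n = List (Subset n)

-- The normal binary delta-matroid D(C) = (E, {A : C[A] nonsingular}).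
D : {n : ℕ} → Matrix n → SetSystem n
D {n} C = filter (λ A → nonsingular C A Data.Bool.≟ true) (allSubsets n)

Feasible : {n : ℕ} → Matrix n → Subset n → Set
Feasible C A = nonsingular C A ≡ true

IsEven : {n : ℕ} → Matrix n → Set
IsEven {n} C = (F F' : Subset n) → Feasible C F → Feasible C F' → ∣ F Δ F' ∣ % 2 ≡ 0

twist : {n : ℕ} → SetSystem n → Subset n → SetSystem n
twist Fs A = map (A Δ_) Fs

-- Width: max feasible cardinality minus min feasible cardinality.
-- (All cardinalities are ≤ n, so folding ⊓ from n gives the minimum of the
-- nonempty family.)
maxSize : {n : ℕ} → SetSystem n → ℕ
maxSize Fs = foldr (λ X m → ∣ X ∣ ⊔ m) 0 Fs

minSize : {n : ℕ} → SetSystem n → ℕ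
minSize {n} Fs = foldr (λ X m → ∣ X ∣ ⊓ m) n Fs

width : {n : ℕ} → SetSystem n → ℕ
width Fs = maxSize Fs ∸ minSize Fs

-- The twist polynomial ∂w_D(z) = Σ_{A ⊆ E} z^{w(D*A)}, given by its
-- coefficient sequence: coefficient of z^j is #{A ⊆ E : w(D*A) = j}.
twistPolyCoeff : {n : ℕ} → SetSystem n → ℕ → ℕ
twistPolyCoeff {n} Fs j = length (filter (λ A → width (twist Fs A) ≟ j) (allSubsets n))

IsMonomial : (ℕ → ℕ) → Set
IsMonomial p = ∃ λ m → ∃ λ k → (p k ≡ m) × ((j : ℕ) → ¬ (j ≡ k) → p j ≡ 0)

-- Intersection graph G_{D(C)}: distinct u, v adjacent iff C u v = 1.
Adj : {n : ℕ} → Matrix n → Fin n → Fin n → Set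
Adj C u v = ¬ (u ≡ v) × C u v ≡ true

data Connected {n : ℕ} (C : Matrix n) (u : Fin n) : Fin n → Set where
  here : Connected C u u
  step : {v w : Fin n} → Connected C u v → Adj C v w → Connected C u w

ComponentsOddComplete : {n : ℕ} → Matrix n → Set
ComponentsOddComplete {n} C =
  (v : Fin n) → ∃ λ (S : Subset n) →
      ((u : Fin n) → (u ∈ S ⇔ Connected C v u))
    × ∣ S ∣ % 2 ≡ 1
    × ((u w : Fin n) → u ∈ S → w ∈ S → ¬ (u ≡ w) → Adj C u w)

module Submission where

-- Let r be the largest size of a feasible set of D = D(C). Since ∅ is feasible and D is
-- even, w(D) = r, all feasible sets (and r) have even size, and C has zero diagonal.
-- (⇒) If the twist polynomial is a single term, every twist D * A has width r. Twisting by an edge,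
-- by a vertex and by a non-edge shows that no maximum feasible set avoids an edge, that every vertex
-- is avoided by some maximum feasible set, and that every non-edge is avoided by one. Kernel vectors
-- of C[F + e] let one exchange any element of a maximum feasible set F for an outside one, which
-- forces adjacency to be transitive; hence closed neighbourhoods are the components and are cliques.
-- They are odd, for otherwise adding one to a maximum feasible set avoiding its centre stays feasible.
-- (⇐) If the components are odd cliques, F is feasible iff it meets every component evenly.
-- Twisting additionally by a vertex x then shifts both the largest and the smallest size of the
-- twisted sets by one, by flipping x together with a suitable partner in its component; so all
-- twists have the same width.

open import Defs
open import Data.Nat as ℕ using (ℕ; zero; suc; _+_; _*_; _∸_; _≤_; _<_; _%_; _⊔_; _⊓_; z≤n; s≤s)
import Data.Nat.Properties
open import Data.Nat.Properties
  using (≤-antisym; ≤-trans; ≤-refl; ≤-pred; <⇒≱; <⇒≢; ≤∧≢⇒<; n<1+n; n≤1+n; 1+n≰n; m≤n⇒m≤1+n; m≤m+n; n≤0⇒n≡0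
        ; +-comm; +-assoc; +-identityʳ; suc-injective; +-cancelʳ-≤; +-monoˡ-≤; ∸-mono; m∸n≤m
        ; m≤m⊔n; m≤n⊔m; m⊓n≤m; m⊓n≤n; ⊔-identityʳ; m≤n⇒m⊔n≡n; m≥n⇒m⊔n≡m; m≤n⇒m⊓n≡m; m≥n⇒m⊓n≡n; ≤-total)
open import Data.Nat.Tactic.RingSolver using (solve-∀)
open import Data.Bool using (Bool; true; false; _xor_; _∧_; _∨_; not; if_then_else_)
import Data.Bool
open import Data.Bool.Properties
  using (∧-comm; ∧-zeroʳ; ∧-identityʳ; ∧-conicalˡ; ∧-conicalʳ; ∨-zeroʳ; ¬-not; not-involutive; not-injective
        ; xor-assoc; xor-comm; xor-same; xor-identityʳ; ∧-distribˡ-xor; ∧-distribʳ-xor; xor-∧-commutativeRing)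
open import Algebra.Bundles using (CommutativeRing)
open import Algebra.Properties.CommutativeSemigroup (CommutativeRing.+-commutativeSemigroup xor-∧-commutativeRing)
  using () renaming (interchange to xor-interchange)
open import Data.Bool.ListAction using (all)
open import Data.Fin using (Fin; zero; suc; _≟_)
open import Data.Fin.Subset using (Subset; ∣_∣; ⊥; _∪_; _∩_)
open import Data.Fin.Subset.Properties using (∣p∣≤n; ∣⊥∣≡0; p⊂q⇒∣p∣<∣q∣; p∩q⊆p; p∩q⊆q)
open import Data.Vec using (Vec; []; _∷_; lookup; tabulate)
open import Data.Vec.Properties
  using (tabulate∘lookup; tabulate-cong; lookup∘tabulate; lookup-zipWith; lookup-replicate; []=⇒lookup; lookup⇒[]=)
open import Data.List using (List; []; _∷_; map; filter; length; allFin)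
open import Data.List.Properties using (filter-all; filter-none)
open import Data.List.Relation.Unary.All as All using ()
open import Data.List.Relation.Unary.Any using (here; there; any?)
open import Data.List.Membership.Propositional using (find; lose) renaming (_∈_ to _∈ₗ_)
open import Data.List.Membership.Propositional.Properties
  using (∈-allFin; ∈-map⁺; ∈-map⁻; ∈-++⁺ˡ; ∈-++⁺ʳ; ∈-filter⁺; ∈-filter⁻)
open import Data.Product using (∃; _×_; _,_; proj₁; proj₂)
open import Data.Sum using (_⊎_; inj₁; inj₂)
open import Data.Empty using (⊥-elim)
import Data.Empty
open import Function using (_∘_)
open import Function.Bundles using (_⇔_; mk⇔; Equivalence)
open import Relation.Binary.PropositionalEquality
open import Relation.Nullary using (¬_; Dec; yes; no; does)
open import Relation.Nullary.Decidable using (dec-true; dec-false; _×-dec_)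

_==_ : ∀ {n} → Fin n → Fin n → Bool
i == j = does (i ≟ j)

==-refl : ∀ {n} (i : Fin n) → (i == i) ≡ true
==-refl i = dec-true (i ≟ i) refl

==-≢ : ∀ {n} {i j : Fin n} → ¬ i ≡ j → (i == j) ≡ false
==-≢ {i = i} {j} = dec-false (i ≟ j)

==⇒≡ : ∀ {n} {i j : Fin n} → (i == j) ≡ true → i ≡ j
==⇒≡ {i = i} {j} e with i ≟ j
... | yes i≡j = i≡j

lookup-ext : ∀ {n} {A : Set} (u v : Vec A n) → (∀ i → lookup u i ≡ lookup v i) → u ≡ v
lookup-ext u v h = trans (sym (tabulate∘lookup u)) (trans (tabulate-cong h) (tabulate∘lookup v))

true≢false : ¬ true ≡ false
true≢false ()

xor≡false⇒≡ : ∀ {a b} → a xor b ≡ false → a ≡ b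
xor≡false⇒≡ {true} {true} _ = refl
xor≡false⇒≡ {false} {false} _ = refl

xor-cancelʳ : ∀ a b → (a xor b) xor b ≡ a
xor-cancelʳ a b = trans (xor-assoc a b b) (trans (cong (a xor_) (xor-same b)) (xor-identityʳ a))

∧-false : ∀ {a b} → (a ≡ true → b ≡ false) → (a ∧ b) ≡ false
∧-false {true} h = h refl
∧-false {false} h = refl

∨-true : ∀ {a b} → (a ∨ b) ≡ true → a ≡ true ⊎ b ≡ true
∨-true {true} _ = inj₁ refl
∨-true {false} e = inj₂ e

implies : ∀ {a b} → (not a ∨ b) ≡ true → a ≡ true → b ≡ true
implies {true} e refl = e

bool-ext : ∀ {a b} → (a ≡ true → b ≡ true) → (b ≡ true → a ≡ true) → a ≡ b
bool-ext {true} {true} _ _ = refl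
bool-ext {false} {false} _ _ = refl
bool-ext {true} {false} h _ = sym (h refl)
bool-ext {false} {true} _ h = h refl

-- Counting and sums over GF(2)

bit : Bool → ℕ
bit true = 1
bit false = 0

count : ∀ {n} → (Fin n → Bool) → ℕ
count {zero} f = 0
count {suc n} f = bit (f zero) + count (f ∘ suc)

count-cong : ∀ {n} {f g : Fin n → Bool} → (∀ i → f i ≡ g i) → count f ≡ count g
count-cong {zero} h = refl
count-cong {suc n} h = cong₂ _+_ (cong bit (h zero)) (count-cong (h ∘ suc))

count-false : ∀ {n} {f : Fin n → Bool} → (∀ i → f i ≡ false) → count f ≡ 0
count-false {zero} h = refl
count-false {suc n} {f} h rewrite h zero = count-false (h ∘ suc)

count≡0⇒false : ∀ {n} (f : Fin n → Bool) → count f ≡ 0 → ∀ i → f i ≡ false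
count≡0⇒false {suc n} f e i with f zero in f0
count≡0⇒false {suc n} f e zero | false = f0
count≡0⇒false {suc n} f e (suc i) | false = count≡0⇒false (f ∘ suc) e i

count>0⇒true : ∀ {n} (f : Fin n → Bool) → 0 < count f → ∃ λ i → f i ≡ true
count>0⇒true {suc n} f h with f zero in f0
... | true = zero , f0
... | false with count>0⇒true (f ∘ suc) h
... | i , fi = suc i , fi

bit-xor : ∀ a b → bit (a xor b) + 2 * bit (a ∧ b) ≡ bit a + bit b
bit-xor true true = refl
bit-xor true false = refl
bit-xor false true = refl
bit-xor false false = refl

bit-∨ : ∀ a b → bit (a ∨ b) + bit (a ∧ b) ≡ bit a + bit b
bit-∨ true true = refl
bit-∨ true false = refl
bit-∨ false true = refl
bit-∨ false false = refl

count-xor : ∀ {n} (f g : Fin n → Bool) →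
  count (λ i → f i xor g i) + 2 * count (λ i → f i ∧ g i) ≡ count f + count g
count-xor {zero} f g = refl
count-xor {suc n} f g = begin
  (bit (a xor b) + count fg) + 2 * (bit (a ∧ b) + count f∧g)
    ≡⟨ shuffle (bit (a xor b)) (bit (a ∧ b)) (count fg) (count f∧g) ⟩
  (bit (a xor b) + 2 * bit (a ∧ b)) + (count fg + 2 * count f∧g)
    ≡⟨ cong₂ _+_ (bit-xor a b) (count-xor (f ∘ suc) (g ∘ suc)) ⟩
  (bit a + bit b) + (count (f ∘ suc) + count (g ∘ suc))
    ≡⟨ +-assoc-swap (bit a) (bit b) (count (f ∘ suc)) (count (g ∘ suc)) ⟩
  (bit a + count (f ∘ suc)) + (bit b + count (g ∘ suc)) ∎
  where
  open ≡-Reasoning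
  a = f zero
  b = g zero
  fg = λ i → f (suc i) xor g (suc i)
  f∧g = λ i → f (suc i) ∧ g (suc i)
  shuffle : ∀ a b c d → (a + c) + 2 * (b + d) ≡ (a + 2 * b) + (c + 2 * d)
  shuffle = solve-∀
  +-assoc-swap : ∀ a b c d → (a + b) + (c + d) ≡ (a + c) + (b + d)
  +-assoc-swap = solve-∀

count-∨ : ∀ {n} (f g : Fin n → Bool) →
  count (λ i → f i ∨ g i) + count (λ i → f i ∧ g i) ≡ count f + count g
count-∨ {zero} f g = refl
count-∨ {suc n} f g = begin
  (bit (a ∨ b) + count f∨g) + (bit (a ∧ b) + count f∧g)
    ≡⟨ +-assoc-swap (bit (a ∨ b)) (count f∨g) (bit (a ∧ b)) (count f∧g) ⟩
  (bit (a ∨ b) + bit (a ∧ b)) + (count f∨g + count f∧g)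
    ≡⟨ cong₂ _+_ (bit-∨ a b) (count-∨ (f ∘ suc) (g ∘ suc)) ⟩
  (bit a + bit b) + (count (f ∘ suc) + count (g ∘ suc))
    ≡⟨ +-assoc-swap (bit a) (bit b) (count (f ∘ suc)) (count (g ∘ suc)) ⟩
  (bit a + count (f ∘ suc)) + (bit b + count (g ∘ suc)) ∎
  where
  open ≡-Reasoning
  a = f zero
  b = g zero
  f∨g = λ i → f (suc i) ∨ g (suc i)
  f∧g = λ i → f (suc i) ∧ g (suc i)
  +-assoc-swap : ∀ a b c d → (a + b) + (c + d) ≡ (a + c) + (b + d)
  +-assoc-swap = solve-∀

count-disjoint-∨ : ∀ {n} (f g : Fin n → Bool) → (∀ i → (f i ∧ g i) ≡ false) →
  count (λ i → f i ∨ g i) ≡ count f + count g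
count-disjoint-∨ f g h = trans (sym (+-identityʳ _))
  (trans (cong (count (λ i → f i ∨ g i) +_) (sym (count-false h))) (count-∨ f g))

count-== : ∀ {n} (x : Fin n) → count (_== x) ≡ 1
count-== {suc n} zero = cong suc (count-false {n} {λ i → suc i == zero} (λ i → refl))
count-== {suc n} (suc x) = count-== x

count-remove : ∀ {n} (f : Fin n → Bool) (x : Fin n) →
  count f ≡ count (λ i → f i ∧ not (i == x)) + bit (f x)
count-remove {suc n} f zero =
  trans (+-comm (bit (f zero)) _)
        (cong (_+ bit (f zero)) (cong₂ _+_ (cong bit (sym (∧-zeroʳ (f zero))))
                                           (count-cong (λ i → sym (∧-identityʳ (f (suc i)))))))
count-remove {suc n} f (suc x) =
  trans (cong (bit (f zero) +_) (count-remove (f ∘ suc) x))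
        (trans (sym (+-assoc (bit (f zero)) (count f∖x) (bit (f (suc x)))))
               (cong (λ b → bit b + count f∖x + bit (f (suc x))) (sym (∧-identityʳ (f zero)))))
  where
  f∖x : Fin n → Bool
  f∖x i = f (suc i) ∧ not (i == x)

count-at : ∀ {n} (f : Fin n → Bool) (x : Fin n) → (∀ i → ¬ i ≡ x → f i ≡ false) → count f ≡ bit (f x)
count-at f x off = trans (count-remove f x) (cong (_+ bit (f x)) (count-false rest))
  where
  rest : ∀ i → (f i ∧ not (i == x)) ≡ false
  rest i = by-cases (i ≟ x)
    where
    by-cases : Dec (i ≡ x) → (f i ∧ not (i == x)) ≡ false
    by-cases (yes refl) = trans (cong (λ b → f i ∧ not b) (==-refl i)) (∧-zeroʳ (f i))
    by-cases (no i≢x) = cong (_∧ not (i == x)) (off i i≢x)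

count-two : ∀ {n} (f : Fin n → Bool) {x y : Fin n} → ¬ x ≡ y →
  (∀ i → ¬ i ≡ x → ¬ i ≡ y → f i ≡ false) → count f ≡ bit (f x) + bit (f y)
count-two f {x} {y} x≢y h = begin
  count f
    ≡⟨ count-remove f x ⟩
  count f-x + bit (f x)
    ≡⟨ cong (_+ bit (f x)) (count-remove f-x y) ⟩
  (count (λ i → f-x i ∧ not (i == y)) + bit (f-x y)) + bit (f x)
    ≡⟨ cong₂ (λ c b → (c + bit b) + bit (f x)) (count-false outside) f-x-y ⟩
  bit (f y) + bit (f x)
    ≡⟨ +-comm (bit (f y)) (bit (f x)) ⟩
  bit (f x) + bit (f y) ∎
  where
  open ≡-Reasoning
  f-x : Fin _ → Bool
  f-x i = f i ∧ not (i == x)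
  f-x-y : f-x y ≡ f y
  f-x-y = trans (cong (λ b → f y ∧ not b) (==-≢ (x≢y ∘ sym))) (∧-identityʳ (f y))
  outside : ∀ i → (f-x i ∧ not (i == y)) ≡ false
  outside i = by-cases (i ≟ x) (i ≟ y)
    where
    by-cases : Dec (i ≡ x) → Dec (i ≡ y) → (f-x i ∧ not (i == y)) ≡ false
    by-cases (yes refl) _ = trans (cong (λ b → (f i ∧ not b) ∧ not (i == y)) (==-refl i)) (cong (_∧ _) (∧-zeroʳ (f i)))
    by-cases (no _) (yes refl) = trans (cong (λ b → f-x i ∧ not b) (==-refl i)) (∧-zeroʳ (f-x i))
    by-cases (no i≢x) (no i≢y) = cong (λ b → (b ∧ not (i == x)) ∧ not (i == y)) (h i i≢x i≢y)

xorSum-cong : ∀ {n} {f g : Fin n → Bool} → (∀ i → f i ≡ g i) → xorSum f ≡ xorSum g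
xorSum-cong {zero} h = refl
xorSum-cong {suc n} h = cong₂ _xor_ (h zero) (xorSum-cong (h ∘ suc))

xorSum-false : ∀ {n} {f : Fin n → Bool} → (∀ i → f i ≡ false) → xorSum f ≡ false
xorSum-false {zero} h = refl
xorSum-false {suc n} {f} h rewrite h zero = xorSum-false (h ∘ suc)

xorSum-xor : ∀ {n} (f g : Fin n → Bool) → xorSum (λ i → f i xor g i) ≡ xorSum f xor xorSum g
xorSum-xor {zero} f g = refl
xorSum-xor {suc n} f g =
  trans (cong ((f zero xor g zero) xor_) (xorSum-xor (f ∘ suc) (g ∘ suc)))
        (xor-interchange (f zero) (g zero) _ _)

xorSum-∧ˡ : ∀ {n} (b : Bool) (f : Fin n → Bool) → xorSum (λ i → b ∧ f i) ≡ b ∧ xorSum f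
xorSum-∧ˡ true f = refl
xorSum-∧ˡ false f = xorSum-false {f = λ i → false ∧ f i} (λ _ → refl)

xorSum-single : ∀ {n} (f : Fin n → Bool) (x : Fin n) → (∀ i → ¬ i ≡ x → f i ≡ false) → xorSum f ≡ f x
xorSum-single {suc n} f zero h =
  trans (cong (f zero xor_) (xorSum-false (λ i → h (suc i) (λ ())))) (xor-identityʳ (f zero))
xorSum-single {suc n} f (suc x) h rewrite h zero (λ ()) =
  xorSum-single (f ∘ suc) x (λ i i≢x → h (suc i) (i≢x ∘ Data.Fin.Properties.suc-injective))
  where import Data.Fin.Properties

xorSum-swap : ∀ {n m} (g : Fin n → Fin m → Bool) →
  xorSum (λ i → xorSum (g i)) ≡ xorSum (λ j → xorSum (λ i → g i j))
xorSum-swap {zero} g = sym (xorSum-false {f = λ j → xorSum (λ i → g i j)} (λ _ → refl))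
xorSum-swap {suc n} g =
  trans (cong (xorSum (g zero) xor_) (xorSum-swap (g ∘ suc)))
        (sym (xorSum-xor (g zero) (λ j → xorSum (λ i → g (suc i) j))))

xorSum-true : ∀ {n} (f : Fin n → Bool) → xorSum f ≡ true → ∃ λ i → f i ≡ true
xorSum-true {suc n} f e with f zero in f0
... | true = zero , f0
... | false with xorSum-true (f ∘ suc) e
... | i , fi = suc i , fi

xorSum-remove : ∀ {n} (f : Fin n → Bool) (x : Fin n) →
  xorSum f ≡ xorSum (λ i → f i ∧ not (i == x)) xor f x
xorSum-remove f x = begin
  xorSum f
    ≡⟨ xorSum-cong (λ i → split (f i) (i == x)) ⟩
  xorSum (λ i → (f i ∧ not (i == x)) xor (f i ∧ (i == x)))
    ≡⟨ xorSum-xor (λ i → f i ∧ not (i == x)) (λ i → f i ∧ (i == x)) ⟩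
  rest xor xorSum (λ i → f i ∧ (i == x))
    ≡⟨ cong (rest xor_) (xorSum-single _ x (λ i i≢x → trans (cong (f i ∧_) (==-≢ i≢x)) (∧-zeroʳ (f i)))) ⟩
  rest xor (f x ∧ (x == x))
    ≡⟨ cong (λ b → rest xor (f x ∧ b)) (==-refl x) ⟩
  rest xor (f x ∧ true)
    ≡⟨ cong (rest xor_) (∧-identityʳ (f x)) ⟩
  rest xor f x ∎
  where
  open ≡-Reasoning
  rest : Bool
  rest = xorSum (λ i → f i ∧ not (i == x))
  split : ∀ a b → a ≡ (a ∧ not b) xor (a ∧ b)
  split true true = refl
  split true false = refl
  split false b = refl

xorSum-two : ∀ {n} (f : Fin n → Bool) {x y : Fin n} → ¬ x ≡ y →
  (∀ i → ¬ i ≡ x → ¬ i ≡ y → f i ≡ false) → xorSum f ≡ f x xor f y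
xorSum-two f {x} {y} x≢y h =
  trans (xorSum-remove f x)
        (trans (cong (_xor f x) rest) (xor-comm (f y) (f x)))
  where
  rest : xorSum (λ i → f i ∧ not (i == x)) ≡ f y
  rest = trans (xorSum-single _ y off-y)
               (trans (cong (λ b → f y ∧ not b) (==-≢ (x≢y ∘ sym))) (∧-identityʳ (f y)))
    where
    off-y : ∀ i → ¬ i ≡ y → (f i ∧ not (i == x)) ≡ false
    off-y i i≢y = by-cases (i ≟ x)
      where
      by-cases : Dec (i ≡ x) → (f i ∧ not (i == x)) ≡ false
      by-cases (yes refl) = trans (cong (λ b → f i ∧ not b) (==-refl i)) (∧-zeroʳ (f i))
      by-cases (no i≢x) = cong (_∧ not (i == x)) (h i i≢x i≢y)

isOdd : ℕ → Bool
isOdd zero = false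
isOdd (suc m) = not (isOdd m)

isOdd-count : ∀ {n} (f : Fin n → Bool) → isOdd (count f) ≡ xorSum f
isOdd-count {zero} f = refl
isOdd-count {suc n} f with f zero
... | true = cong not (isOdd-count (f ∘ suc))
... | false = isOdd-count (f ∘ suc)

%2≡if-isOdd : ∀ m → m % 2 ≡ (if isOdd m then 1 else 0)
%2≡if-isOdd zero = refl
%2≡if-isOdd (suc zero) = refl
%2≡if-isOdd (suc (suc m)) =
  trans (%2≡if-isOdd m) (cong (if_then 1 else 0) (sym (not-involutive (isOdd m))))

isOdd⇒%2≡1 : ∀ m → isOdd m ≡ true → m % 2 ≡ 1
isOdd⇒%2≡1 m odd = trans (%2≡if-isOdd m) (cong (if_then 1 else 0) odd)

%2≡1⇒isOdd : ∀ m → m % 2 ≡ 1 → isOdd m ≡ true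
%2≡1⇒isOdd m e with isOdd m in odd | trans (sym (%2≡if-isOdd m)) e
... | true | _ = refl

%2≡0⇒¬isOdd : ∀ m → m % 2 ≡ 0 → isOdd m ≡ false
%2≡0⇒¬isOdd m e with isOdd m in odd | trans (sym (%2≡if-isOdd m)) e
... | false | _ = refl

isOdd-+2 : ∀ a b → isOdd a ≡ isOdd b → a < b → 2 + a ≤ b
isOdd-+2 zero (suc zero) () _
isOdd-+2 zero (suc (suc b)) _ _ = s≤s (s≤s z≤n)
isOdd-+2 (suc a) (suc b) e (s≤s a<b) = s≤s (isOdd-+2 a b (not-injective e) a<b)

+2*suc⇒≤ : ∀ a b c → a + 2 * suc c ≡ 2 + b → a ≤ b
+2*suc⇒≤ a b c e = subst (a ≤_) (suc-injective (suc-injective (trans (sym (shift a c)) e))) (m≤m+n a (2 * c))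
  where
  shift : ∀ a c → a + 2 * suc c ≡ 2 + (a + 2 * c)
  shift = solve-∀

n≤n∸2⇒n≡0 : ∀ n → n ≤ n ∸ 2 → n ≡ 0
n≤n∸2⇒n≡0 zero _ = refl
n≤n∸2⇒n≡0 (suc zero) ()
n≤n∸2⇒n≡0 (suc (suc n)) le = ⊥-elim (1+n≰n (≤-trans (n≤1+n (suc n)) le))

_!_ : ∀ {n} → Subset n → Fin n → Bool
_!_ = lookup

IsZero : ∀ {n} → Subset n → Set
IsZero x = ∀ j → x ! j ≡ false

_⊆_ : ∀ {n} → Subset n → Subset n → Set
x ⊆ A = ∀ j → x ! j ≡ true → A ! j ≡ true

⊆-trans : ∀ {n} {x y z : Subset n} → x ⊆ y → y ⊆ z → x ⊆ z
⊆-trans x⊆y y⊆z j xj = y⊆z j (x⊆y j xj)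

VanishesOn : ∀ {n} → (Fin n → Bool) → Subset n → Set
VanishesOn v A = ∀ i → A ! i ≡ true → v i ≡ false

VanishesOn-⊆ : ∀ {n} {v : Fin n → Bool} {A B} → A ⊆ B → VanishesOn v B → VanishesOn v A
VanishesOn-⊆ A⊆B vB i Ai = vB i (A⊆B i Ai)

_·_ : ∀ {n} → Subset n → (Fin n → Bool) → Bool
y · v = xorSum (λ i → y ! i ∧ v i)

tabulate-! : ∀ {n} (f : Fin n → Bool) j → tabulate f ! j ≡ f j
tabulate-! = lookup∘tabulate

Δ-! : ∀ {n} (A B : Subset n) j → (A Δ B) ! j ≡ (A ! j xor B ! j)
Δ-! A B j = lookup-zipWith _xor_ j A B

⊥-! : ∀ {n} (j : Fin n) → ⊥ ! j ≡ false
⊥-! j = lookup-replicate j false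

∩-! : ∀ {n} (A B : Subset n) j → (A ∩ B) ! j ≡ (A ! j ∧ B ! j)
∩-! A B j = lookup-zipWith _∧_ j A B

∪-! : ∀ {n} (A B : Subset n) j → (A ∪ B) ! j ≡ (A ! j ∨ B ! j)
∪-! A B j = lookup-zipWith _∨_ j A B

Δ-self : ∀ {n} (A : Subset n) → A Δ A ≡ ⊥
Δ-self A = lookup-ext _ _ λ j → trans (Δ-! A A j) (trans (xor-same (A ! j)) (sym (⊥-! j)))

Δ-comm : ∀ {n} (A B : Subset n) → A Δ B ≡ B Δ A
Δ-comm A B = lookup-ext _ _ λ j → trans (Δ-! A B j) (trans (xor-comm (A ! j) (B ! j)) (sym (Δ-! B A j)))

Δ-assoc : ∀ {n} (A B E : Subset n) → (A Δ B) Δ E ≡ A Δ (B Δ E)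
Δ-assoc A B E = lookup-ext _ _ λ j → begin
  ((A Δ B) Δ E) ! j               ≡⟨ trans (Δ-! (A Δ B) E j) (cong (_xor E ! j) (Δ-! A B j)) ⟩
  (A ! j xor B ! j) xor E ! j     ≡⟨ xor-assoc (A ! j) (B ! j) (E ! j) ⟩
  A ! j xor (B ! j xor E ! j)     ≡⟨ sym (trans (Δ-! A (B Δ E) j) (cong (A ! j xor_) (Δ-! B E j))) ⟩
  (A Δ (B Δ E)) ! j ∎
  where open ≡-Reasoning

Δ-cancelˡ : ∀ {n} (A B : Subset n) → A Δ (A Δ B) ≡ B
Δ-cancelˡ A B = lookup-ext _ _ λ j →
  trans (Δ-! A (A Δ B) j) (trans (cong (A ! j xor_) (Δ-! A B j))
    (trans (sym (xor-assoc (A ! j) (A ! j) (B ! j))) (cong (_xor B ! j) (xor-same (A ! j)))))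

⊥-Δ : ∀ {n} (A : Subset n) → ⊥ Δ A ≡ A
⊥-Δ A = lookup-ext _ _ λ j → trans (Δ-! ⊥ A j) (cong (_xor A ! j) (⊥-! j))

∣∣≡count : ∀ {n} (v : Subset n) → ∣ v ∣ ≡ count (v !_)
∣∣≡count [] = refl
∣∣≡count (true ∷ v) = cong suc (∣∣≡count v)
∣∣≡count (false ∷ v) = ∣∣≡count v

∣tabulate∣ : ∀ {n} (f : Fin n → Bool) → ∣ tabulate f ∣ ≡ count f
∣tabulate∣ f = trans (∣∣≡count (tabulate f)) (count-cong (tabulate-! f))

∣Δ∣≡count : ∀ {n} (A B : Subset n) → ∣ A Δ B ∣ ≡ count (λ j → A ! j xor B ! j)
∣Δ∣≡count A B = trans (∣∣≡count (A Δ B)) (count-cong (Δ-! A B))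

∣∩∣≡count : ∀ {n} (A B : Subset n) → ∣ A ∩ B ∣ ≡ count (λ j → A ! j ∧ B ! j)
∣∩∣≡count A B = trans (∣∣≡count (A ∩ B)) (count-cong (∩-! A B))

∣∪∣+∣∩∣ : ∀ {n} (A B : Subset n) → ∣ A ∪ B ∣ + ∣ A ∩ B ∣ ≡ ∣ A ∣ + ∣ B ∣
∣∪∣+∣∩∣ A B = begin
  ∣ A ∪ B ∣ + ∣ A ∩ B ∣
    ≡⟨ cong₂ _+_ (trans (∣∣≡count (A ∪ B)) (count-cong (∪-! A B))) (∣∩∣≡count A B) ⟩
  count (λ j → A ! j ∨ B ! j) + count (λ j → A ! j ∧ B ! j)
    ≡⟨ count-∨ (A !_) (B !_) ⟩
  count (A !_) + count (B !_)
    ≡⟨ sym (cong₂ _+_ (∣∣≡count A) (∣∣≡count B)) ⟩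
  ∣ A ∣ + ∣ B ∣ ∎
  where open ≡-Reasoning

∣Δ∣+2∣∩∣ : ∀ {n} (A B : Subset n) → ∣ A Δ B ∣ + 2 * ∣ A ∩ B ∣ ≡ ∣ A ∣ + ∣ B ∣
∣Δ∣+2∣∩∣ A B =
  trans (cong₂ (λ a b → a + 2 * b) (∣Δ∣≡count A B) (∣∩∣≡count A B))
        (trans (count-xor (A !_) (B !_)) (sym (cong₂ _+_ (∣∣≡count A) (∣∣≡count B))))

∣∣≡0⇒≡⊥ : ∀ {n} (A : Subset n) → ∣ A ∣ ≡ 0 → A ≡ ⊥
∣∣≡0⇒≡⊥ A e = lookup-ext _ _ λ j →
  trans (count≡0⇒false (A !_) (trans (sym (∣∣≡count A)) e) j) (sym (⊥-! j))

∣Δ∣≡0⇒≡ : ∀ {n} (A B : Subset n) → ∣ A Δ B ∣ ≡ 0 → A ≡ B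
∣Δ∣≡0⇒≡ A B e = lookup-ext A B λ j →
  xor≡false⇒≡ (count≡0⇒false (λ j → A ! j xor B ! j) (trans (sym (∣Δ∣≡count A B)) e) j)

isOdd-∣∣ : ∀ {n} (X : Subset n) → isOdd ∣ X ∣ ≡ xorSum (X !_)
isOdd-∣∣ X = trans (cong isOdd (∣∣≡count X)) (isOdd-count (X !_))

isOdd-∣Δ∣ : ∀ {n} (A B : Subset n) → isOdd ∣ A Δ B ∣ ≡ isOdd ∣ A ∣ xor isOdd ∣ B ∣
isOdd-∣Δ∣ A B = begin
  isOdd ∣ A Δ B ∣                       ≡⟨ isOdd-∣∣ (A Δ B) ⟩
  xorSum ((A Δ B) !_)                   ≡⟨ xorSum-cong (Δ-! A B) ⟩
  xorSum (λ j → A ! j xor B ! j)        ≡⟨ xorSum-xor (A !_) (B !_) ⟩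
  xorSum (A !_) xor xorSum (B !_)       ≡⟨ sym (cong₂ _xor_ (isOdd-∣∣ A) (isOdd-∣∣ B)) ⟩
  isOdd ∣ A ∣ xor isOdd ∣ B ∣ ∎
  where open ≡-Reasoning

isOdd-∣∩∣ : ∀ {n} (A B : Subset n) → isOdd ∣ A ∩ B ∣ ≡ A · (B !_)
isOdd-∣∩∣ A B = trans (isOdd-∣∣ (A ∩ B)) (xorSum-cong (∩-! A B))

isOdd-∣Δ∩∣ : ∀ {n} (A B S : Subset n) → isOdd ∣ (A Δ B) ∩ S ∣ ≡ isOdd ∣ A ∩ S ∣ xor isOdd ∣ B ∩ S ∣
isOdd-∣Δ∩∣ A B S = begin
  isOdd ∣ (A Δ B) ∩ S ∣                                ≡⟨ isOdd-∣∩∣ (A Δ B) S ⟩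
  xorSum (λ j → (A Δ B) ! j ∧ S ! j)
    ≡⟨ xorSum-cong (λ j → trans (cong (_∧ S ! j) (Δ-! A B j)) (∧-distribʳ-xor (S ! j) (A ! j) (B ! j))) ⟩
  xorSum (λ j → (A ! j ∧ S ! j) xor (B ! j ∧ S ! j))   ≡⟨ xorSum-xor (λ j → A ! j ∧ S ! j) (λ j → B ! j ∧ S ! j) ⟩
  A · (S !_) xor B · (S !_)                            ≡⟨ sym (cong₂ _xor_ (isOdd-∣∩∣ A S) (isOdd-∣∩∣ B S)) ⟩
  isOdd ∣ A ∩ S ∣ xor isOdd ∣ B ∩ S ∣ ∎
  where open ≡-Reasoning

∈-allSubsets : ∀ {n} (v : Subset n) → v ∈ₗ allSubsets n
∈-allSubsets [] = here refl
∈-allSubsets {suc n} (false ∷ v) = ∈-++⁺ˡ (∈-map⁺ (false ∷_) (∈-allSubsets v))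
∈-allSubsets {suc n} (true ∷ v) = ∈-++⁺ʳ (map (false ∷_) (allSubsets n)) (∈-map⁺ (true ∷_) (∈-allSubsets v))

insert : ∀ {n} → Subset n → Fin n → Subset n
insert F u = tabulate (λ j → F ! j ∨ (j == u))

remove : ∀ {n} → Subset n → Fin n → Subset n
remove F v = tabulate (λ j → F ! j ∧ not (j == v))

singleton : ∀ {n} → Fin n → Subset n
singleton u = tabulate (_== u)

⊆-insert : ∀ {n} (F : Subset n) u → F ⊆ insert F u
⊆-insert F u j Fj = trans (tabulate-! _ j) (cong (_∨ (j == u)) Fj)

insert-∋ : ∀ {n} (F : Subset n) u → insert F u ! u ≡ true
insert-∋ F u = trans (tabulate-! _ u) (trans (cong (F ! u ∨_) (==-refl u)) (∨-zeroʳ (F ! u)))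

insert-⊎ : ∀ {n} (F : Subset n) u j → insert F u ! j ≡ true → F ! j ≡ true ⊎ j ≡ u
insert-⊎ F u j e with ∨-true (trans (sym (tabulate-! _ j)) e)
... | inj₁ Fj = inj₁ Fj
... | inj₂ j==u = inj₂ (==⇒≡ j==u)

insert-⊆ : ∀ {n} {F A : Subset n} {u} → F ⊆ A → A ! u ≡ true → insert F u ⊆ A
insert-⊆ {F = F} {u = u} F⊆A Au j e with insert-⊎ F u j e
... | inj₁ Fj = F⊆A j Fj
... | inj₂ refl = Au

insert-⊆-remove : ∀ {n} {y F : Subset n} {u} → y ⊆ insert F u → y ! u ≡ false → y ⊆ F
insert-⊆-remove {F = F} {u} y⊆ yu j yj with insert-⊎ F u j (y⊆ j yj)
... | inj₁ Fj = Fj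
... | inj₂ refl = ⊥-elim (true≢false (trans (sym yj) yu))

∉-insert : ∀ {n} (F : Subset n) {u x} → ¬ x ≡ u → F ! x ≡ false → insert F u ! x ≡ false
∉-insert F {u} {x} x≢u Fx = trans (tabulate-! _ x) (cong₂ _∨_ Fx (==-≢ x≢u))

∣insert∣ : ∀ {n} (F : Subset n) u → F ! u ≡ false → ∣ insert F u ∣ ≡ suc ∣ F ∣
∣insert∣ F u Fu = begin
  ∣ insert F u ∣                   ≡⟨ ∣tabulate∣ (λ j → F ! j ∨ (j == u)) ⟩
  count (λ j → F ! j ∨ (j == u))   ≡⟨ count-disjoint-∨ (F !_) (_== u) disjoint ⟩
  count (F !_) + count (_== u)     ≡⟨ cong₂ _+_ (sym (∣∣≡count F)) (count-== u) ⟩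
  ∣ F ∣ + 1                        ≡⟨ +-comm ∣ F ∣ 1 ⟩
  suc ∣ F ∣ ∎
  where
  open ≡-Reasoning
  disjoint : ∀ j → (F ! j ∧ (j == u)) ≡ false
  disjoint j = ∧-false λ Fj → ¬-not λ j==u → true≢false (trans (sym Fj) (trans (cong (F !_) (==⇒≡ j==u)) Fu))

remove-⊆ : ∀ {n} (F : Subset n) v → remove F v ⊆ F
remove-⊆ F v j e = ∧-conicalˡ (F ! j) _ (trans (sym (tabulate-! _ j)) e)

remove-∌ : ∀ {n} (F : Subset n) v → remove F v ! v ≡ false
remove-∌ F v = trans (tabulate-! _ v) (trans (cong (λ b → F ! v ∧ not b) (==-refl v)) (∧-zeroʳ (F ! v)))

remove-∋ : ∀ {n} (F : Subset n) {v j} → F ! j ≡ true → ¬ j ≡ v → remove F v ! j ≡ true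
remove-∋ F {v} {j} Fj j≢v = trans (tabulate-! _ j) (cong₂ (λ a b → a ∧ not b) Fj (==-≢ j≢v))

∉-remove : ∀ {n} (F : Subset n) v {x} → F ! x ≡ false → remove F v ! x ≡ false
∉-remove F v {x} Fx = trans (tabulate-! _ x) (cong (_∧ not (x == v)) Fx)

∣remove∣ : ∀ {n} (F : Subset n) v → F ! v ≡ true → suc ∣ remove F v ∣ ≡ ∣ F ∣
∣remove∣ F v Fv = begin
  suc ∣ remove F v ∣                         ≡⟨ cong suc (∣tabulate∣ (λ j → F ! j ∧ not (j == v))) ⟩
  suc (count (λ j → F ! j ∧ not (j == v)))   ≡⟨ +-comm 1 _ ⟩
  count (λ j → F ! j ∧ not (j == v)) + 1     ≡⟨ cong (λ b → count (λ j → F ! j ∧ not (j == v)) + bit b) (sym Fv) ⟩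
  count (λ j → F ! j ∧ not (j == v)) + bit (F ! v) ≡⟨ sym (count-remove (F !_) v) ⟩
  count (F !_)                               ≡⟨ sym (∣∣≡count F) ⟩
  ∣ F ∣ ∎
  where open ≡-Reasoning

∣insert-remove∣ : ∀ {n} (F : Subset n) {u v} → F ! u ≡ false → F ! v ≡ true →
  ∣ insert (remove F v) u ∣ ≡ ∣ F ∣
∣insert-remove∣ F {u} {v} Fu Fv = trans (∣insert∣ (remove F v) u (∉-remove F v Fu)) (∣remove∣ F v Fv)

insert-mono : ∀ {n} {A B : Subset n} u → A ⊆ B → insert A u ⊆ insert B u
insert-mono {A = A} {B} u A⊆B = insert-⊆ {F = A} {insert B u} (⊆-trans {x = A} {B} {insert B u} A⊆B (⊆-insert B u)) (insert-∋ B u)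

insert-comm-⊆ : ∀ {n} (F : Subset n) u j → insert (insert F u) j ⊆ insert (insert F j) u
insert-comm-⊆ F u j = insert-⊆ {F = insert F u} {insert (insert F j) u}
  (insert-mono {A = F} {insert F j} u (⊆-insert F j)) (⊆-insert (insert F j) u j (insert-∋ F j))

insert-remove-⊆ : ∀ {n} (F : Subset n) u v → insert (remove F v) u ⊆ insert F u
insert-remove-⊆ F u v = insert-⊆ {F = remove F v} {insert F u}
  (⊆-trans {x = remove F v} {F} {insert F u} (remove-⊆ F v) (⊆-insert F u)) (insert-∋ F u)

insert-⊆-insert-remove : ∀ {n} (F : Subset n) u v → insert F u ⊆ insert (insert (remove F v) u) v
insert-⊆-insert-remove F u v = insert-⊆ {F = F} {insert G v} F⊆G+v (⊆-insert G v u (insert-∋ (remove F v) u))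
  where
  G = insert (remove F v) u
  F⊆G+v : F ⊆ insert G v
  F⊆G+v j Fj with j ≟ v
  ... | yes refl = insert-∋ G j
  ... | no j≢v = ⊆-insert G v j (⊆-insert (remove F v) u j (remove-∋ F Fj j≢v))

count-outside-Δ : ∀ {n} (F y z : Subset n) {e} → F ! e ≡ false → y ! e ≡ true → z ⊆ insert F e → z ! e ≡ true →
  suc (count (λ j → (y Δ z) ! j ∧ not (F ! j))) ≡ count (λ j → y ! j ∧ not (F ! j))
count-outside-Δ F y z {e} Fe ye z⊆ ze = begin
  suc (count (λ j → (y Δ z) ! j ∧ not (F ! j)))          ≡⟨ cong suc (count-cong drops-e) ⟩
  suc (count (λ j → (y ! j ∧ not (F ! j)) ∧ not (j == e))) ≡⟨ +-comm 1 _ ⟩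
  count (λ j → (y ! j ∧ not (F ! j)) ∧ not (j == e)) + 1
    ≡⟨ cong (λ b → count (λ j → (y ! j ∧ not (F ! j)) ∧ not (j == e)) + bit b) (sym (cong₂ (λ a b → a ∧ not b) ye Fe)) ⟩
  count (λ j → (y ! j ∧ not (F ! j)) ∧ not (j == e)) + bit (y ! e ∧ not (F ! e))
    ≡⟨ sym (count-remove (λ j → y ! j ∧ not (F ! j)) e) ⟩
  count (λ j → y ! j ∧ not (F ! j)) ∎
  where
  open ≡-Reasoning
  drops-e : ∀ j → (y Δ z) ! j ∧ not (F ! j) ≡ (y ! j ∧ not (F ! j)) ∧ not (j == e)
  drops-e j with F ! j in Fj
  ... | true = trans (∧-zeroʳ _) (sym (cong (_∧ not (j == e)) (∧-zeroʳ (y ! j))))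
  ... | false = by-cases (j ≟ e)
    where
    by-cases : Dec (j ≡ e) → (y Δ z) ! j ∧ true ≡ (y ! j ∧ true) ∧ not (j == e)
    by-cases (yes refl) = begin
      (y Δ z) ! j ∧ true              ≡⟨ trans (∧-identityʳ _) (trans (Δ-! y z j) (cong₂ _xor_ ye ze)) ⟩
      false                           ≡⟨ sym (∧-zeroʳ (y ! j ∧ true)) ⟩
      (y ! j ∧ true) ∧ false          ≡⟨ cong (λ b → (y ! j ∧ true) ∧ not b) (sym (==-refl j)) ⟩
      (y ! j ∧ true) ∧ not (j == j) ∎
    by-cases (no j≢e) = begin
      (y Δ z) ! j ∧ true              ≡⟨ cong (_∧ true) (trans (Δ-! y z j) (cong (y ! j xor_) zj)) ⟩
      (y ! j xor false) ∧ true        ≡⟨ cong (_∧ true) (xor-identityʳ (y ! j)) ⟩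
      y ! j ∧ true                    ≡⟨ sym (∧-identityʳ _) ⟩
      (y ! j ∧ true) ∧ true           ≡⟨ cong (λ b → (y ! j ∧ true) ∧ not b) (sym (==-≢ j≢e)) ⟩
      (y ! j ∧ true) ∧ not (j == e) ∎
      where
      zj : z ! j ≡ false
      zj = ¬-not λ zj → true≢false (trans (sym (z⊆ j zj)) (∉-insert F j≢e Fj))

singleton-! : ∀ {n} (u j : Fin n) → singleton u ! j ≡ (j == u)
singleton-! u = tabulate-! (_== u)

∣singleton∣ : ∀ {n} (u : Fin n) → ∣ singleton u ∣ ≡ 1
∣singleton∣ u = trans (∣tabulate∣ (_== u)) (count-== u)

⊆-singleton : ∀ {n} (x : Subset n) a → x ⊆ singleton a → ∀ j → ¬ j ≡ a → x ! j ≡ false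
⊆-singleton x a x⊆ j j≢a = ¬-not λ xj → true≢false (trans (sym (x⊆ j xj)) (trans (singleton-! a j) (==-≢ j≢a)))

∣singleton∩∣ : ∀ {n} (v : Fin n) X → ∣ singleton v ∩ X ∣ ≡ bit (X ! v)
∣singleton∩∣ v X = begin
  ∣ singleton v ∩ X ∣                            ≡⟨ ∣∩∣≡count (singleton v) X ⟩
  count (λ j → singleton v ! j ∧ X ! j)           ≡⟨ count-at _ v off ⟩
  bit (singleton v ! v ∧ X ! v)                   ≡⟨ cong (λ b → bit (b ∧ X ! v)) (trans (singleton-! v v) (==-refl v)) ⟩
  bit (X ! v) ∎
  where
  open ≡-Reasoning
  off : ∀ j → ¬ j ≡ v → (singleton v ! j ∧ X ! j) ≡ false
  off j j≢v = cong (_∧ X ! j) (trans (singleton-! v j) (==-≢ j≢v))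

∣singletonΔ∣ : ∀ {n} (v : Fin n) X → ∣ singleton v Δ X ∣ + 2 * bit (X ! v) ≡ suc ∣ X ∣
∣singletonΔ∣ v X = begin
  ∣ singleton v Δ X ∣ + 2 * bit (X ! v)         ≡⟨ cong (λ c → ∣ singleton v Δ X ∣ + 2 * c) (sym (∣singleton∩∣ v X)) ⟩
  ∣ singleton v Δ X ∣ + 2 * ∣ singleton v ∩ X ∣ ≡⟨ ∣Δ∣+2∣∩∣ (singleton v) X ⟩
  ∣ singleton v ∣ + ∣ X ∣                       ≡⟨ cong (_+ ∣ X ∣) (∣singleton∣ v) ⟩
  suc ∣ X ∣ ∎
  where open ≡-Reasoning

∣singletonΔ∣-∈ : ∀ {n} {v : Fin n} {X} → X ! v ≡ true → suc ∣ singleton v Δ X ∣ ≡ ∣ X ∣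
∣singletonΔ∣-∈ {v = v} {X} Xv =
  suc-injective (trans (+-comm 2 ∣ singleton v Δ X ∣)
    (subst (λ b → ∣ singleton v Δ X ∣ + 2 * bit b ≡ suc ∣ X ∣) Xv (∣singletonΔ∣ v X)))

∣singletonΔ∣-∉ : ∀ {n} {v : Fin n} {X} → X ! v ≡ false → ∣ singleton v Δ X ∣ ≡ suc ∣ X ∣
∣singletonΔ∣-∉ {v = v} {X} Xv =
  trans (sym (+-identityʳ _)) (subst (λ b → ∣ singleton v Δ X ∣ + 2 * bit b ≡ suc ∣ X ∣) Xv (∣singletonΔ∣ v X))

∣singletonΔ∣≤ : ∀ {n} (v : Fin n) X → ∣ singleton v Δ X ∣ ≤ suc ∣ X ∣
∣singletonΔ∣≤ v X = subst (∣ singleton v Δ X ∣ ≤_) (∣singletonΔ∣ v X) (m≤m+n _ _)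

pair : ∀ {n} → Fin n → Fin n → Subset n
pair a b = insert (singleton a) b

pair-∋ˡ : ∀ {n} (a b : Fin n) → pair a b ! a ≡ true
pair-∋ˡ a b = ⊆-insert (singleton a) b a (trans (singleton-! a a) (==-refl a))

pair-∋ʳ : ∀ {n} (a b : Fin n) → pair a b ! b ≡ true
pair-∋ʳ a b = insert-∋ (singleton a) b

pair-∌ : ∀ {n} {a b j : Fin n} → ¬ j ≡ a → ¬ j ≡ b → pair a b ! j ≡ false
pair-∌ {a = a} {b} {j} j≢a j≢b = ∉-insert (singleton a) j≢b (trans (singleton-! a j) (==-≢ j≢a))

⊆-pair : ∀ {n} (y : Subset n) a b → y ⊆ pair a b → ∀ j → ¬ j ≡ a → ¬ j ≡ b → y ! j ≡ false
⊆-pair y a b y⊆ j j≢a j≢b = ¬-not λ yj → true≢false (trans (sym (y⊆ j yj)) (pair-∌ j≢a j≢b))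

∣pair∣ : ∀ {n} {a b : Fin n} → ¬ a ≡ b → ∣ pair a b ∣ ≡ 2
∣pair∣ {a = a} {b} a≢b =
  trans (∣insert∣ (singleton a) b (trans (singleton-! a b) (==-≢ (a≢b ∘ sym)))) (cong suc (∣singleton∣ a))

∣pair∩∣ : ∀ {n} {a b : Fin n} → ¬ a ≡ b → ∀ X → ∣ pair a b ∩ X ∣ ≡ bit (X ! a) + bit (X ! b)
∣pair∩∣ {a = a} {b} a≢b X = trans (∣∩∣≡count (pair a b) X)
  (trans (count-two (λ j → pair a b ! j ∧ X ! j) a≢b (λ j j≢a j≢b → cong (_∧ X ! j) (pair-∌ j≢a j≢b)))
         (cong₂ (λ p q → bit (p ∧ X ! a) + bit (q ∧ X ! b)) (pair-∋ˡ a b) (pair-∋ʳ a b)))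

∣pairΔ∣ : ∀ {n} {a b : Fin n} → ¬ a ≡ b → ∀ X →
  ∣ pair a b Δ X ∣ + 2 * (bit (X ! a) + bit (X ! b)) ≡ 2 + ∣ X ∣
∣pairΔ∣ {a = a} {b} a≢b X = begin
  ∣ pair a b Δ X ∣ + 2 * (bit (X ! a) + bit (X ! b))  ≡⟨ cong (λ c → ∣ pair a b Δ X ∣ + 2 * c) (sym (∣pair∩∣ a≢b X)) ⟩
  ∣ pair a b Δ X ∣ + 2 * ∣ pair a b ∩ X ∣             ≡⟨ ∣Δ∣+2∣∩∣ (pair a b) X ⟩
  ∣ pair a b ∣ + ∣ X ∣                                ≡⟨ cong (_+ ∣ X ∣) (∣pair∣ a≢b) ⟩
  2 + ∣ X ∣ ∎
  where open ≡-Reasoning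

∣pairΔ∣-swap : ∀ {n} {a b : Fin n} → ¬ a ≡ b → ∀ {X} → X ! a ≡ true → X ! b ≡ false → ∣ pair a b Δ X ∣ ≡ ∣ X ∣
∣pairΔ∣-swap {a = a} {b} a≢b {X} Xa Xb = suc-injective (suc-injective
  (trans (+-comm 2 ∣ pair a b Δ X ∣)
    (subst₂ (λ p q → ∣ pair a b Δ X ∣ + 2 * (bit p + bit q) ≡ 2 + ∣ X ∣) Xa Xb (∣pairΔ∣ a≢b X))))

∣pairΔ∣-both : ∀ {n} {a b : Fin n} → ¬ a ≡ b → ∀ {X} → X ! a ≡ true → X ! b ≡ true → 2 + ∣ pair a b Δ X ∣ ≡ ∣ X ∣
∣pairΔ∣-both {a = a} {b} a≢b {X} Xa Xb = suc-injective (suc-injective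
  (trans (+-comm 4 ∣ pair a b Δ X ∣)
    (subst₂ (λ p q → ∣ pair a b Δ X ∣ + 2 * (bit p + bit q) ≡ 2 + ∣ X ∣) Xa Xb (∣pairΔ∣ a≢b X))))

maxSize-ub : ∀ {n} (L : List (Subset n)) {X} → X ∈ₗ L → ∣ X ∣ ≤ maxSize L
maxSize-ub (Y ∷ L) (here refl) = m≤m⊔n _ _
maxSize-ub (Y ∷ L) (there X∈L) = ≤-trans (maxSize-ub L X∈L) (m≤n⊔m _ _)

minSize-lb : ∀ {n} (L : List (Subset n)) {X} → X ∈ₗ L → minSize L ≤ ∣ X ∣
minSize-lb (Y ∷ L) (here refl) = m⊓n≤m _ _
minSize-lb (Y ∷ L) (there X∈L) = ≤-trans (m⊓n≤n _ _) (minSize-lb L X∈L)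

maxSize-attained : ∀ {n} (L : List (Subset n)) {X₀} → X₀ ∈ₗ L →
  ∃ λ X → X ∈ₗ L × ∣ X ∣ ≡ maxSize L
maxSize-attained (Y ∷ []) _ = Y , here refl , sym (⊔-identityʳ _)
maxSize-attained (Y ∷ Z ∷ L) _ with maxSize-attained (Z ∷ L) (here refl) | ≤-total ∣ Y ∣ (maxSize (Z ∷ L))
... | X , X∈L , eX | inj₁ Y≤ = X , there X∈L , trans eX (sym (m≤n⇒m⊔n≡n Y≤))
... | _ | inj₂ ≤Y = Y , here refl , sym (m≥n⇒m⊔n≡m ≤Y)

minSize-attained : ∀ {n} (L : List (Subset n)) {X₀} → X₀ ∈ₗ L →
  ∃ λ X → X ∈ₗ L × ∣ X ∣ ≡ minSize L
minSize-attained (Y ∷ []) _ = Y , here refl , sym (m≤n⇒m⊓n≡m (∣p∣≤n Y))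
minSize-attained (Y ∷ Z ∷ L) _ with minSize-attained (Z ∷ L) (here refl) | ≤-total ∣ Y ∣ (minSize (Z ∷ L))
... | _ | inj₁ Y≤ = Y , here refl , sym (m≤n⇒m⊓n≡m Y≤)
... | X , X∈L , eX | inj₂ ≤Y = X , there X∈L , trans eX (sym (m≥n⇒m⊓n≡n ≤Y))

-- Feasible sets of D(C) as sets with trivial kernel

Feasible⇒∈D : ∀ {n} {C : Matrix n} F → Feasible C F → F ∈ₗ D C
Feasible⇒∈D {C = C} F = ∈-filter⁺ (λ A → nonsingular C A Data.Bool.≟ true) (∈-allSubsets F)

∈D⇒Feasible : ∀ {n} {C : Matrix n} {F} → F ∈ₗ D C → Feasible C F
∈D⇒Feasible {n} {C} F∈D = proj₂ (∈-filter⁻ (λ A → nonsingular C A Data.Bool.≟ true) {xs = allSubsets n} F∈D)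

all-∈ : ∀ {A : Set} (p : A → Bool) (xs : List A) → all p xs ≡ true → ∀ {x} → x ∈ₗ xs → p x ≡ true
all-∈ p (y ∷ xs) e (here refl) = ∧-conicalˡ (p y) _ e
all-∈ p (y ∷ xs) e (there x∈xs) = all-∈ p xs (∧-conicalʳ (p y) _ e) x∈xs

all-intro : ∀ {A : Set} (p : A → Bool) (xs : List A) → (∀ x → p x ≡ true) → all p xs ≡ true
all-intro p [] h = refl
all-intro p (y ∷ xs) h rewrite h y = all-intro p xs h

all-false : ∀ {A : Set} (p : A → Bool) (xs : List A) → all p xs ≡ false → ∃ λ x → p x ≡ false
all-false p (y ∷ xs) e with p y in py
... | true = all-false p xs e
... | false = y , py

isEmptyB⇒IsZero : ∀ {n} (x : Subset n) → isEmptyB x ≡ true → IsZero x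
isEmptyB⇒IsZero (false ∷ x) e zero = refl
isEmptyB⇒IsZero (false ∷ x) e (suc j) = isEmptyB⇒IsZero x e j

IsZero⇒isEmptyB : ∀ {n} (x : Subset n) → IsZero x → isEmptyB x ≡ true
IsZero⇒isEmptyB [] z = refl
IsZero⇒isEmptyB (b ∷ x) z rewrite z zero = IsZero⇒isEmptyB x (z ∘ suc)

isEmptyB≡false⇒nonzero : ∀ {n} (x : Subset n) → isEmptyB x ≡ false → ∃ λ j → x ! j ≡ true
isEmptyB≡false⇒nonzero (true ∷ x) e = zero , refl
isEmptyB≡false⇒nonzero (false ∷ x) e with isEmptyB≡false⇒nonzero x e
... | j , xj = suc j , xj

_*ᵥ_ : ∀ {n} → Matrix n → Subset n → Fin n → Bool
(C *ᵥ x) i = xorSum (λ j → C i j ∧ x ! j)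

InKernel : ∀ {n} → Matrix n → Subset n → Subset n → Set
InKernel C A x = x ⊆ A × VanishesOn (C *ᵥ x) A

rowProd≡*ᵥ : ∀ {n} (C : Matrix n) A x → x ⊆ A → ∀ i → rowProd C A x i ≡ (C *ᵥ x) i
rowProd≡*ᵥ C A x x⊆A i = xorSum-cong λ j → cong (C i j ∧_) (masked (x⊆A j))
  where
  masked : ∀ {a b} → (b ≡ true → a ≡ true) → a ∧ b ≡ b
  masked {a} {false} h = ∧-zeroʳ a
  masked {a} {true} h rewrite h refl = refl

inKernel⇒InKernel : ∀ {n} (C : Matrix n) A x → inKernel C A x ≡ true → InKernel C A x
inKernel⇒InKernel {n} C A x e = x⊆A , vanishes
  where
  x⊆A : x ⊆ A
  x⊆A j = implies (all-∈ _ (allFin n) (∧-conicalˡ _ _ e) (∈-allFin j))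
  vanishes : VanishesOn (C *ᵥ x) A
  vanishes i Ai = trans (sym (rowProd≡*ᵥ C A x x⊆A i))
    (not-injective (implies (all-∈ _ (allFin n) (∧-conicalʳ _ _ e) (∈-allFin i)) Ai))

InKernel⇒inKernel : ∀ {n} (C : Matrix n) A x → InKernel C A x → inKernel C A x ≡ true
InKernel⇒inKernel {n} C A x (x⊆A , vanishes) =
  cong₂ _∧_ (all-intro _ (allFin n) supported) (all-intro _ (allFin n) rows)
  where
  supported : ∀ j → (not (x ! j) ∨ A ! j) ≡ true
  supported j with x ! j in xj
  ... | false = refl
  ... | true = x⊆A j xj
  rows : ∀ i → (not (A ! i) ∨ not (rowProd C A x i)) ≡ true
  rows i with A ! i in Ai
  ... | false = refl
  ... | true = cong not (trans (rowProd≡*ᵥ C A x x⊆A i) (vanishes i Ai))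

Feasible⇒kernel-trivial : ∀ {n} {C : Matrix n} {A} → Feasible C A → ∀ x → InKernel C A x → IsZero x
Feasible⇒kernel-trivial {n} {C} {A} fA x kx =
  isEmptyB⇒IsZero x (implies (all-∈ _ (allSubsets n) fA (∈-allSubsets x)) (InKernel⇒inKernel C A x kx))

kernel-trivial⇒Feasible : ∀ {n} {C : Matrix n} {A} → (∀ x → InKernel C A x → IsZero x) → Feasible C A
kernel-trivial⇒Feasible {n} {C} {A} h = all-intro _ (allSubsets n) trivial
  where
  trivial : ∀ x → (not (inKernel C A x) ∨ isEmptyB x) ≡ true
  trivial x with inKernel C A x in kx
  ... | false = refl
  ... | true = IsZero⇒isEmptyB x (h x (inKernel⇒InKernel C A x kx))

¬Feasible⇒kernel-nonzero : ∀ {n} {C : Matrix n} {A} → ¬ Feasible C A →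
  ∃ λ x → InKernel C A x × ∃ λ j → x ! j ≡ true
¬Feasible⇒kernel-nonzero {n} {C} {A} ¬fA
  with all-false (λ x → not (inKernel C A x) ∨ isEmptyB x) (allSubsets n) (¬-not ¬fA)
... | x , witness = x , inKernel⇒InKernel C A x (kernel witness) , isEmptyB≡false⇒nonzero x (nonempty witness)
  where
  kernel : ∀ {a b} → (not a ∨ b) ≡ false → a ≡ true
  kernel {true} _ = refl
  nonempty : ∀ {a b} → (not a ∨ b) ≡ false → b ≡ false
  nonempty {true} e = e

*ᵥ-Δ : ∀ {n} (C : Matrix n) x y i → (C *ᵥ (x Δ y)) i ≡ (C *ᵥ x) i xor (C *ᵥ y) i
*ᵥ-Δ C x y i =
  trans (xorSum-cong λ j → trans (cong (C i j ∧_) (Δ-! x y j)) (∧-distribˡ-xor (C i j) (x ! j) (y ! j)))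
        (xorSum-xor (λ j → C i j ∧ x ! j) (λ j → C i j ∧ y ! j))

InKernel-Δ : ∀ {n} {C : Matrix n} {A x y} → InKernel C A x → InKernel C A y → InKernel C A (x Δ y)
InKernel-Δ {C = C} {A} {x} {y} (x⊆A , vx) (y⊆A , vy) =
  (λ j e → either (x ! j) (y ! j) (trans (sym (Δ-! x y j)) e) (x⊆A j) (y⊆A j)) ,
  (λ i Ai → trans (*ᵥ-Δ C x y i) (cong₂ _xor_ (vx i Ai) (vy i Ai)))
  where
  either : ∀ {c} a b → (a xor b) ≡ true → (a ≡ true → c ≡ true) → (b ≡ true → c ≡ true) → c ≡ true
  either true _ _ ha _ = ha refl
  either false b e _ hb = hb e

*ᵥ-supported-at : ∀ {n} (C : Matrix n) (x : Subset n) a → (∀ j → ¬ j ≡ a → x ! j ≡ false) →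
  ∀ i → (C *ᵥ x) i ≡ C i a ∧ x ! a
*ᵥ-supported-at C x a off i = xorSum-single (λ j → C i j ∧ x ! j) a λ j j≢a → trans (cong (C i j ∧_) (off j j≢a)) (∧-zeroʳ (C i j))

*ᵥ-supported-on-pair : ∀ {n} (C : Matrix n) (y : Subset n) {a b} → ¬ a ≡ b →
  (∀ j → ¬ j ≡ a → ¬ j ≡ b → y ! j ≡ false) → ∀ i → (C *ᵥ y) i ≡ (C i a ∧ y ! a) xor (C i b ∧ y ! b)
*ᵥ-supported-on-pair C y a≢b off i =
  xorSum-two (λ j → C i j ∧ y ! j) a≢b (λ j j≢a j≢b → trans (cong (C i j ∧_) (off j j≢a j≢b)) (∧-zeroʳ (C i j)))

*ᵥ-symmetric : ∀ {n} {C : Matrix n} → Symmetric C → ∀ y z → y · (C *ᵥ z) ≡ z · (C *ᵥ y)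
*ᵥ-symmetric {C = C} symC y z = begin
  xorSum (λ i → y ! i ∧ (C *ᵥ z) i)
    ≡⟨ xorSum-cong (λ i → sym (xorSum-∧ˡ (y ! i) (λ j → C i j ∧ z ! j))) ⟩
  xorSum (λ i → xorSum (λ j → y ! i ∧ (C i j ∧ z ! j)))
    ≡⟨ xorSum-swap (λ i j → y ! i ∧ (C i j ∧ z ! j)) ⟩
  xorSum (λ j → xorSum (λ i → y ! i ∧ (C i j ∧ z ! j)))
    ≡⟨ xorSum-cong (λ j → xorSum-cong (λ i → transpose (y ! i) (z ! j) (symC i j))) ⟩
  xorSum (λ j → xorSum (λ i → z ! j ∧ (C j i ∧ y ! i)))
    ≡⟨ xorSum-cong (λ j → xorSum-∧ˡ (z ! j) (λ i → C j i ∧ y ! i)) ⟩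
  xorSum (λ j → z ! j ∧ (C *ᵥ y) j) ∎
  where
  open ≡-Reasoning
  transpose : ∀ a b {c d} → c ≡ d → a ∧ (c ∧ b) ≡ b ∧ (d ∧ a)
  transpose true true refl = refl
  transpose true false {c} refl = ∧-zeroʳ c
  transpose false true {c} refl = sym (∧-zeroʳ c)
  transpose false false refl = refl

·-vanish : ∀ {n} {y A : Subset n} (v : Fin n → Bool) → y ⊆ A → VanishesOn v A → y · v ≡ false
·-vanish {y = y} v y⊆A vA = xorSum-false λ i → ∧-false λ yi → vA i (y⊆A i yi)

·-insert : ∀ {n} {y A : Subset n} a (v : Fin n → Bool) → y ⊆ insert A a → VanishesOn v A →
  y · v ≡ y ! a ∧ v a
·-insert {y = y} {A} a v y⊆ vA =
  xorSum-single (λ i → y ! i ∧ v i) a λ i i≢a → ∧-false λ yi → off i i≢a (insert-⊎ A a i (y⊆ i yi))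
  where
  off : ∀ i → ¬ i ≡ a → A ! i ≡ true ⊎ i ≡ a → v i ≡ false
  off i _ (inj₁ Ai) = vA i Ai
  off i i≢a (inj₂ i≡a) = ⊥-elim (i≢a i≡a)

module Twists {n : ℕ} (C : Matrix n) where

  ⊥-feasible : Feasible C ⊥
  ⊥-feasible = kernel-trivial⇒Feasible {C = C} {⊥} λ x (x⊆⊥ , _) j →
    ¬-not λ xj → true≢false (trans (sym (x⊆⊥ j xj)) (⊥-! j))

  rank : ℕ
  rank = maxSize (D C)

  Feasible⇒≤rank : ∀ F → Feasible C F → ∣ F ∣ ≤ rank
  Feasible⇒≤rank F fF = maxSize-ub (D C) (Feasible⇒∈D {C = C} F fF)

  rank-attained : ∃ λ F → Feasible C F × ∣ F ∣ ≡ rank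
  rank-attained with maxSize-attained (D C) (Feasible⇒∈D {C = C} ⊥ ⊥-feasible)
  ... | F , F∈D , eF = F , ∈D⇒Feasible {C = C} F∈D , eF

  maxTwist minTwist : Subset n → ℕ
  maxTwist A = maxSize (twist (D C) A)
  minTwist A = minSize (twist (D C) A)

  ≤maxTwist : ∀ A F → Feasible C F → ∣ A Δ F ∣ ≤ maxTwist A
  ≤maxTwist A F fF = maxSize-ub (twist (D C) A) (∈-map⁺ (A Δ_) (Feasible⇒∈D {C = C} F fF))

  minTwist≤ : ∀ A F → Feasible C F → minTwist A ≤ ∣ A Δ F ∣
  minTwist≤ A F fF = minSize-lb (twist (D C) A) (∈-map⁺ (A Δ_) (Feasible⇒∈D {C = C} F fF))

  maxTwist-attained : ∀ A → ∃ λ F → Feasible C F × ∣ A Δ F ∣ ≡ maxTwist A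
  maxTwist-attained A
    with maxSize-attained (twist (D C) A) (∈-map⁺ (A Δ_) (Feasible⇒∈D {C = C} ⊥ ⊥-feasible))
  ... | X , X∈ , eX with ∈-map⁻ (A Δ_) X∈
  ... | F , F∈D , refl = F , ∈D⇒Feasible {C = C} F∈D , eX

  minTwist-attained : ∀ A → ∃ λ F → Feasible C F × ∣ A Δ F ∣ ≡ minTwist A
  minTwist-attained A
    with minSize-attained (twist (D C) A) (∈-map⁺ (A Δ_) (Feasible⇒∈D {C = C} ⊥ ⊥-feasible))
  ... | X , X∈ , eX with ∈-map⁻ (A Δ_) X∈
  ... | F , F∈D , refl = F , ∈D⇒Feasible {C = C} F∈D , eX

  maxTwist-lub : ∀ A b → (∀ F → Feasible C F → ∣ A Δ F ∣ ≤ b) → maxTwist A ≤ b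
  maxTwist-lub A b h with maxTwist-attained A
  ... | F , fF , eF = subst (_≤ b) eF (h F fF)

  minTwist-glb : ∀ A b → (∀ F → Feasible C F → b ≤ ∣ A Δ F ∣) → b ≤ minTwist A
  minTwist-glb A b h with minTwist-attained A
  ... | F , fF , eF = subst (b ≤_) eF (h F fF)

  Feasible⇒minTwist≡0 : ∀ A → Feasible C A → minTwist A ≡ 0
  Feasible⇒minTwist≡0 A fA = n≤0⇒n≡0 (subst (minTwist A ≤_) (trans (cong ∣_∣ (Δ-self A)) (∣⊥∣≡0 n)) (minTwist≤ A A fA))

  width-⊥ : width (twist (D C) ⊥) ≡ rank
  width-⊥ = cong₂ _∸_ max⊥ min⊥
    where
    ∣⊥Δ∣ : ∀ F → ∣ ⊥ Δ F ∣ ≡ ∣ F ∣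
    ∣⊥Δ∣ F = cong ∣_∣ (⊥-Δ F)
    max⊥ : maxTwist ⊥ ≡ rank
    max⊥ with rank-attained
    ... | F , fF , eF = ≤-antisym
      (maxTwist-lub ⊥ rank (λ F fF → subst (_≤ rank) (sym (∣⊥Δ∣ F)) (Feasible⇒≤rank F fF)))
      (subst (_≤ maxTwist ⊥) (trans (∣⊥Δ∣ F) eF) (≤maxTwist ⊥ F fF))
    min⊥ : minTwist ⊥ ≡ 0
    min⊥ = n≤0⇒n≡0 (subst (minTwist ⊥ ≤_) (trans (∣⊥Δ∣ ⊥) (∣⊥∣≡0 n)) (minTwist≤ ⊥ ⊥ ⊥-feasible))

-- Even normal binary delta-matroids

IsCliqueComponent : ∀ {n} → Matrix n → Subset n → Set
IsCliqueComponent C S = ∀ i → S ! i ≡ true → ∀ j → C i j ≡ (S ! j ∧ not (j == i))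

module Even {n : ℕ} {C : Matrix n} (symC : Symmetric C) (evC : IsEven C) where

  open Twists C public

  feasible-even : ∀ F → Feasible C F → isOdd ∣ F ∣ ≡ false
  feasible-even F fF = %2≡0⇒¬isOdd ∣ F ∣ (subst (λ X → ∣ X ∣ % 2 ≡ 0) (⊥-Δ F) (evC ⊥ F ⊥-feasible fF))

  kernel-insert-trivial : ∀ F {u} y → Feasible C F → InKernel C (insert F u) y → y ! u ≡ false → IsZero y
  kernel-insert-trivial F {u} y fF (y⊆ , vy) yu =
    Feasible⇒kernel-trivial {C = C} {F} fF y
      (insert-⊆-remove {y = y} {F} {u} y⊆ yu , VanishesOn-⊆ {v = C *ᵥ y} {F} {insert F u} (⊆-insert F u) vy)

  -- insert F u has odd size, so it is infeasible and its kernel has a nonzero vector, which cannot avoid u.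
  kernel-vector : ∀ F {u} → Feasible C F → F ! u ≡ false →
    ∃ λ z → InKernel C (insert F u) z × z ! u ≡ true
  kernel-vector F {u} fF Fu with ¬Feasible⇒kernel-nonzero {C = C} {insert F u} insert-infeasible
    where
    insert-infeasible : ¬ Feasible C (insert F u)
    insert-infeasible fI = true≢false (begin
      true                    ≡⟨ cong not (sym (feasible-even F fF)) ⟩
      not (isOdd ∣ F ∣)       ≡⟨ cong isOdd (sym (∣insert∣ F u Fu)) ⟩
      isOdd ∣ insert F u ∣    ≡⟨ feasible-even (insert F u) fI ⟩
      false ∎)
      where open ≡-Reasoning
  ... | z , kz , j , zj with z ! u in zu
  ... | true = z , kz , zu
  ... | false = ⊥-elim (true≢false (trans (sym zj) (kernel-insert-trivial F z fF kz zu j)))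

  diagonal-zero : ∀ i → C i i ≡ false
  diagonal-zero i = ¬-not λ Cii →
    true≢false (trans (cong isOdd (sym (∣singleton∣ i))) (feasible-even (singleton i) (singleton-feasible Cii)))
    where
    singleton-feasible : C i i ≡ true → Feasible C (singleton i)
    singleton-feasible Cii = kernel-trivial⇒Feasible {C = C} {singleton i} λ x (x⊆ , vx) j →
      by-cases x (⊆-singleton x i x⊆) vx j (j ≟ i)
      where
      by-cases : ∀ x → (∀ j → ¬ j ≡ i → x ! j ≡ false) → VanishesOn (C *ᵥ x) (singleton i) →
        ∀ j → Dec (j ≡ i) → x ! j ≡ false
      by-cases x off vx j (no j≢i) = off j j≢i
      by-cases x off vx j (yes refl) = begin
        x ! j             ≡⟨ cong (_∧ x ! j) (sym Cii) ⟩
        C j j ∧ x ! j     ≡⟨ sym (*ᵥ-supported-at C x j off j) ⟩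
        (C *ᵥ x) j        ≡⟨ vx j (trans (singleton-! j j) (==-refl j)) ⟩
        false ∎
        where open ≡-Reasoning

  adjacent⇒≢ : ∀ {a b} → C a b ≡ true → ¬ a ≡ b
  adjacent⇒≢ {a} Cab refl = true≢false (trans (sym Cab) (diagonal-zero a))

  adjacent-pair-feasible : ∀ {a b} → C a b ≡ true → Feasible C (pair a b)
  adjacent-pair-feasible {a} {b} Cab = kernel-trivial⇒Feasible {C = C} {pair a b} trivial
    where
    a≢b = adjacent⇒≢ Cab
    trivial : ∀ y → InKernel C (pair a b) y → IsZero y
    trivial y (y⊆ , vy) j with j ≟ a | j ≟ b
    ... | yes refl | _ = begin
      y ! j                                  ≡⟨ sym (xor-identityʳ (y ! j)) ⟩
      y ! j xor false
        ≡⟨ cong₂ (λ p q → (p ∧ y ! j) xor (q ∧ y ! b)) (sym (trans (symC b j) Cab)) (sym (diagonal-zero b)) ⟩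
      (C b j ∧ y ! j) xor (C b b ∧ y ! b)    ≡⟨ sym (*ᵥ-supported-on-pair C y a≢b (⊆-pair y a b y⊆) b) ⟩
      (C *ᵥ y) b                             ≡⟨ vy b (pair-∋ʳ a b) ⟩
      false ∎
      where open ≡-Reasoning
    ... | no _ | yes refl = begin
      y ! j                                  ≡⟨ cong₂ (λ p q → (p ∧ y ! a) xor (q ∧ y ! j)) (sym (diagonal-zero a)) (sym Cab) ⟩
      (C a a ∧ y ! a) xor (C a j ∧ y ! j)    ≡⟨ sym (*ᵥ-supported-on-pair C y a≢b (⊆-pair y a b y⊆) a) ⟩
      (C *ᵥ y) a                             ≡⟨ vy a (pair-∋ˡ a b) ⟩
      false ∎
      where open ≡-Reasoning
    ... | no j≢a | no j≢b = ⊆-pair y a b y⊆ j j≢a j≢b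

  non-adjacent-pair-infeasible : ∀ {a b} → C a b ≡ false → ¬ Feasible C (pair a b)
  non-adjacent-pair-infeasible {a} {b} Cab fP =
    true≢false (trans (sym (trans (singleton-! a a) (==-refl a)))
                      (Feasible⇒kernel-trivial {C = C} {pair a b} fP (singleton a) (⊆-insert (singleton a) b , vanishes) a))
    where
    vanishes : VanishesOn (C *ᵥ singleton a) (pair a b)
    vanishes i Pi = trans (*ᵥ-supported-at C (singleton a) a (⊆-singleton (singleton a) a (λ _ e → e)) i)
                          (trans (cong (C i a ∧_) (trans (singleton-! a a) (==-refl a)))
                                 (trans (∧-identityʳ (C i a)) (endpoint (insert-⊎ (singleton a) b i Pi))))
      where
      endpoint : singleton a ! i ≡ true ⊎ i ≡ b → C i a ≡ false
      endpoint (inj₁ e) = subst (λ k → C k a ≡ false) (sym (==⇒≡ (trans (sym (singleton-! a i)) e))) (diagonal-zero a)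
      endpoint (inj₂ refl) = trans (symC i a) Cab

  closed-complete⇒clique-component : ∀ S →
    (∀ {i j} → S ! i ≡ true → C i j ≡ true → S ! j ≡ true) →
    (∀ {a b} → S ! a ≡ true → S ! b ≡ true → ¬ a ≡ b → C a b ≡ true) → IsCliqueComponent C S
  closed-complete⇒clique-component S closed complete i Si j = by-cases (j ≟ i) (S ! j) refl
    where
    by-cases : Dec (j ≡ i) → ∀ b → S ! j ≡ b → C i j ≡ (S ! j ∧ not (j == i))
    by-cases (yes refl) _ _ = trans (diagonal-zero j)
      (sym (trans (cong (λ t → S ! j ∧ not t) (==-refl j)) (∧-zeroʳ (S ! j))))
    by-cases (no j≢i) true Sj = trans (complete Si Sj (j≢i ∘ sym))
      (sym (cong₂ (λ p t → p ∧ not t) Sj (==-≢ j≢i)))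
    by-cases (no j≢i) false Sj = trans (¬-not λ Cij → true≢false (trans (sym (closed Si Cij)) Sj))
      (sym (cong (_∧ not (j == i)) Sj))

  kernel-pairing : ∀ y w {A B} a → y ⊆ insert A a → VanishesOn (C *ᵥ w) A →
    w ⊆ B → VanishesOn (C *ᵥ y) B → y ! a ∧ (C *ᵥ w) a ≡ false
  kernel-pairing y w {A} {B} a y⊆ vw w⊆B vy = begin
    y ! a ∧ (C *ᵥ w) a   ≡⟨ sym (·-insert {y = y} {A} a (C *ᵥ w) y⊆ vw) ⟩
    y · (C *ᵥ w)         ≡⟨ *ᵥ-symmetric symC y w ⟩
    w · (C *ᵥ y)         ≡⟨ ·-vanish {y = w} {B} (C *ᵥ y) w⊆B vy ⟩
    false ∎
    where open ≡-Reasoning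

  kernel-pairing-swap : ∀ y w {A B} a b → y ⊆ insert A a → VanishesOn (C *ᵥ w) A →
    w ⊆ insert B b → VanishesOn (C *ᵥ y) B → y ! a ∧ (C *ᵥ w) a ≡ w ! b ∧ (C *ᵥ y) b
  kernel-pairing-swap y w {A} {B} a b y⊆ vw w⊆ vy = begin
    y ! a ∧ (C *ᵥ w) a   ≡⟨ sym (·-insert {y = y} {A} a (C *ᵥ w) y⊆ vw) ⟩
    y · (C *ᵥ w)         ≡⟨ *ᵥ-symmetric symC y w ⟩
    w · (C *ᵥ y)         ≡⟨ ·-insert {y = w} {B} b (C *ᵥ y) w⊆ vy ⟩
    w ! b ∧ (C *ᵥ y) b ∎
    where open ≡-Reasoning

  exchange : ∀ F {u v} z → Feasible C F → F ! u ≡ false → F ! v ≡ true →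
    InKernel C (insert F u) z → z ! u ≡ true → z ! v ≡ true → Feasible C (insert (remove F v) u)
  exchange F {u} {v} z fF Fu Fv (z⊆ , vz) zu zv = kernel-trivial⇒Feasible {C = C} {G} trivial
    where
    G = insert (remove F v) u
    G⊆F+u = insert-remove-⊆ F u v
    F+u⊆G+v = insert-⊆-insert-remove F u v

    v∉G : G ! v ≡ false
    v∉G = ∉-insert (remove F v) (λ v≡u → true≢false (trans (sym Fv) (trans (cong (F !_) v≡u) Fu))) (remove-∌ F v)

    vanishes-at-v : ∀ y → InKernel C G y → (C *ᵥ y) v ≡ false
    vanishes-at-v y (y⊆G , vy) = trans (cong (_∧ (C *ᵥ y) v) (sym zv))
      (kernel-pairing z y {G} {insert F u} v (⊆-trans {x = z} {insert F u} {insert G v} z⊆ F+u⊆G+v) vy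
                      (⊆-trans {x = y} {G} {insert F u} y⊆G G⊆F+u) vz)

    kernel-F+u : ∀ y → InKernel C G y → InKernel C (insert F u) y
    kernel-F+u y (y⊆G , vy) = ⊆-trans {x = y} {G} {insert F u} y⊆G G⊆F+u , vanishes
      where
      vanishes : VanishesOn (C *ᵥ y) (insert F u)
      vanishes i i∈ with insert-⊎ G v i (F+u⊆G+v i i∈)
      ... | inj₁ Gi = vy i Gi
      ... | inj₂ refl = vanishes-at-v y (y⊆G , vy)

    trivial : ∀ y → InKernel C G y → IsZero y
    trivial y ky with y ! u in yu
    ... | false = kernel-insert-trivial F y fF (kernel-F+u y ky) yu
    ... | true = ⊥-elim (true≢false (trans (sym (proj₁ ky v y≡z-at-v)) v∉G))
      where
      -- y Δ z lies in the kernel of C[F + u] and avoids u, so it is zero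
      y≡z-at-v : y ! v ≡ true
      y≡z-at-v = trans (xor≡false⇒≡ (trans (sym (Δ-! y z v)) (y+z≡0 v))) zv
        where
        y+z≡0 : IsZero (y Δ z)
        y+z≡0 = kernel-insert-trivial F (y Δ z) fF
          (InKernel-Δ {C = C} {insert F u} {y} {z} (kernel-F+u y ky) (z⊆ , vz))
          (trans (Δ-! y z u) (cong₂ _xor_ yu zu))

  two-point-extension : ∀ F {u j} z w → Feasible C F →
    InKernel C (insert F u) z → (C *ᵥ z) j ≡ true →
    InKernel C (insert F j) w → (C *ᵥ w) u ≡ true →
    Feasible C (insert (insert F u) j)
  two-point-extension F {u} {j} z w fF (z⊆ , vz) Czj (w⊆ , vw) Cwu =
    kernel-trivial⇒Feasible {C = C} {G} trivial
    where
    G = insert (insert F u) j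

    F+u⊆G : insert F u ⊆ G
    F+u⊆G = ⊆-insert (insert F u) j

    F+j⊆G : insert F j ⊆ G
    F+j⊆G = insert-mono {A = F} {insert F u} j (⊆-insert F u)

    trivial : ∀ y → InKernel C G y → IsZero y
    trivial y (y⊆G , vy) = Feasible⇒kernel-trivial {C = C} {F} fF y (y⊆F , VanishesOn-⊆ {v = C *ᵥ y} {F} {G} F⊆G vy)
      where
      F⊆G : F ⊆ G
      F⊆G = ⊆-trans {x = F} {insert F u} {G} (⊆-insert F u) F+u⊆G
      yj : y ! j ≡ false
      yj = trans (sym (∧-identityʳ (y ! j)))
        (trans (cong (y ! j ∧_) (sym Czj)) (kernel-pairing y z {insert F u} {G} j y⊆G vz (⊆-trans {x = z} {insert F u} {G} z⊆ F+u⊆G) vy))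
      yu : y ! u ≡ false
      yu = trans (sym (∧-identityʳ (y ! u)))
        (trans (cong (y ! u ∧_) (sym Cwu))
          (kernel-pairing y w {insert F j} {G} u (⊆-trans {x = y} {G} {insert (insert F j) u} y⊆G (insert-comm-⊆ F u j)) vw
                          (⊆-trans {x = w} {insert F j} {G} w⊆ F+j⊆G) vy))
      y⊆F : y ⊆ F
      y⊆F = insert-⊆-remove {y = y} {F} {u} (insert-⊆-remove {y = y} {insert F u} {j} y⊆G yj) yu

  -- A coordinate j with (C z) j = 1 outside F + u would make F + u + j feasible, exceeding the rank.
  kernel-vector-global : ∀ F {u} z → Feasible C F → ∣ F ∣ ≡ rank → F ! u ≡ false →
    InKernel C (insert F u) z → z ! u ≡ true → ∀ j → (C *ᵥ z) j ≡ false
  kernel-vector-global F {u} z fF maxF Fu (z⊆ , vz) zu j with insert F u ! j in j∈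
  ... | true = vz j j∈
  ... | false = ¬-not λ Czj → <⇒≱ too-large (Feasible⇒≤rank G (extension Czj (kernel-vector F fF Fj)))
    where
    G = insert (insert F u) j
    Fj : F ! j ≡ false
    Fj = ¬-not λ Fj → true≢false (trans (sym (⊆-insert F u j Fj)) j∈)
    extension : (C *ᵥ z) j ≡ true → (∃ λ w → InKernel C (insert F j) w × w ! j ≡ true) → Feasible C G
    extension Czj (w , (w⊆ , vw) , wj) = two-point-extension F z w fF (z⊆ , vz) Czj (w⊆ , vw) Cwu
      where
      Cwu : (C *ᵥ w) u ≡ true
      Cwu = begin
        (C *ᵥ w) u           ≡⟨ cong (_∧ (C *ᵥ w) u) (sym zu) ⟩
        z ! u ∧ (C *ᵥ w) u   ≡⟨ kernel-pairing-swap z w {F} {F} u j z⊆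
                                  (VanishesOn-⊆ {v = C *ᵥ w} {F} {insert F j} (⊆-insert F j) vw) w⊆
                                  (VanishesOn-⊆ {v = C *ᵥ z} {F} {insert F u} (⊆-insert F u) vz) ⟩
        w ! j ∧ (C *ᵥ z) j   ≡⟨ cong₂ _∧_ wj Czj ⟩
        true ∎
        where open ≡-Reasoning
    too-large : rank < ∣ G ∣
    too-large = subst (rank <_) (sym (trans (∣insert∣ (insert F u) j j∈) (cong suc (∣insert∣ F u Fu))))
                      (subst (_< suc (suc ∣ F ∣)) maxF (m≤n⇒m≤1+n (n<1+n ∣ F ∣)))

  non-maximum-gap : ∀ F → Feasible C F → ¬ ∣ F ∣ ≡ rank → 2 + ∣ F ∣ ≤ rank
  non-maximum-gap F fF ≢rank with rank-attained
  ... | F₀ , fF₀ , eF₀ = isOdd-+2 ∣ F ∣ rank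
    (trans (feasible-even F fF) (sym (trans (cong isOdd (sym eF₀)) (feasible-even F₀ fF₀))))
    (≤∧≢⇒< (Feasible⇒≤rank F fF) ≢rank)

  -- The coordinates of y outside F are eliminated one at a time by adding kernel vectors of the C[F + e].
  exchange-partner : ∀ F {v} → Feasible C F → F ! v ≡ true →
    ∀ y → VanishesOn (C *ᵥ y) F → y ! v ≡ true →
    ∃ λ e → F ! e ≡ false × ∃ λ z → InKernel C (insert F e) z × z ! e ≡ true × z ! v ≡ true
  exchange-partner F {v} fF Fv y₀ vy₀ y₀v = eliminate _ y₀ vy₀ y₀v refl
    where
    eliminate : ∀ k y → VanishesOn (C *ᵥ y) F → y ! v ≡ true → count (λ j → y ! j ∧ not (F ! j)) ≡ k →
      ∃ λ e → F ! e ≡ false × ∃ λ z → InKernel C (insert F e) z × z ! e ≡ true × z ! v ≡ true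
    eliminate zero y vy yv none =
      ⊥-elim (true≢false (trans (sym yv) (Feasible⇒kernel-trivial {C = C} {F} fF y (y⊆F , vy) v)))
      where
      y⊆F : y ⊆ F
      y⊆F j yj = not-injective (trans (cong (_∧ not (F ! j)) (sym yj)) (count≡0⇒false _ none j))
    eliminate (suc k) y vy yv some with count>0⇒true (λ j → y ! j ∧ not (F ! j)) (subst (0 <_) (sym some) (s≤s z≤n))
    ... | e , ye∉F with kernel-vector F {e} fF (not-injective (∧-conicalʳ (y ! e) _ ye∉F))
    ... | z , (z⊆ , vz) , ze with z ! v in zv
    ... | true = e , not-injective (∧-conicalʳ (y ! e) _ ye∉F) , z , (z⊆ , vz) , ze , zv
    ... | false = eliminate k (y Δ z) vy′ (trans (Δ-! y z v) (cong₂ _xor_ yv zv))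
                    (suc-injective (trans (count-outside-Δ F y z (not-injective (∧-conicalʳ (y ! e) _ ye∉F))
                                                           (∧-conicalˡ (y ! e) _ ye∉F) z⊆ ze) some))
      where
      vy′ : VanishesOn (C *ᵥ (y Δ z)) F
      vy′ i Fi = trans (*ᵥ-Δ C y z i) (cong₂ _xor_ (vy i Fi) (vz i (⊆-insert F e i Fi)))

module CliqueComponent {n : ℕ} {C : Matrix n} (symC : Symmetric C) {S : Subset n}
                       (S-clique : IsCliqueComponent C S) where

  *ᵥ-inside : ∀ y i → S ! i ≡ true → (C *ᵥ y) i ≡ S · (y !_) xor y ! i
  *ᵥ-inside y i Si = begin
    (C *ᵥ y) i                            ≡⟨ xorSum-cong (λ j → cong (_∧ y ! j) (S-clique i Si j)) ⟩
    xorSum (λ j → (S ! j ∧ not (j == i)) ∧ y ! j) ≡⟨ xorSum-cong (λ j → rearrange (S ! j) (not (j == i)) (y ! j)) ⟩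
    xorSum (λ j → (S ! j ∧ y ! j) ∧ not (j == i)) ≡⟨ sym (xor-cancelʳ _ ((S ! i) ∧ y ! i)) ⟩
    (xorSum (λ j → (S ! j ∧ y ! j) ∧ not (j == i)) xor (S ! i ∧ y ! i)) xor (S ! i ∧ y ! i)
      ≡⟨ cong₂ _xor_ (sym (xorSum-remove (λ j → S ! j ∧ y ! j) i)) (cong (_∧ y ! i) Si) ⟩
    S · (y !_) xor y ! i ∎
    where
    open ≡-Reasoning
    rearrange : ∀ a b c → (a ∧ b) ∧ c ≡ (a ∧ c) ∧ b
    rearrange true b c = ∧-comm b c
    rearrange false b c = refl

  *ᵥ-outside : ∀ y i → S ! i ≡ false → y ⊆ S → (C *ᵥ y) i ≡ false
  *ᵥ-outside y i Si y⊆S = xorSum-false λ j → ∧-false λ Cij →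
    ¬-not λ yj → true≢false (trans (sym Cij) (trans (symC i j) (trans (S-clique j (y⊆S j yj) i) (cong (_∧ not (i == j)) Si))))

  feasible-meets-evenly : ∀ F → Feasible C F → isOdd ∣ F ∩ S ∣ ≡ false
  feasible-meets-evenly F fF = ¬-not λ odd → odd-meet-impossible (trans (sym (isOdd-∣∩∣ F S)) odd)
    where
    y = F ∩ S
    y⊆F : y ⊆ F
    y⊆F j yj = ∧-conicalˡ (F ! j) _ (trans (sym (∩-! F S j)) yj)
    y⊆S : y ⊆ S
    y⊆S j yj = ∧-conicalʳ (F ! j) _ (trans (sym (∩-! F S j)) yj)
    odd-meet-impossible : F · (S !_) ≡ true → Data.Empty.⊥
    odd-meet-impossible odd with xorSum-true (λ j → F ! j ∧ S ! j) odd
    ... | j , FSj = true≢false (trans (sym (trans (∩-! F S j) FSj)) (Feasible⇒kernel-trivial {C = C} {F} fF y (y⊆F , vanishes) j))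
      where
      S·y : S · (y !_) ≡ true
      S·y = trans (xorSum-cong λ j → trans (cong (S ! j ∧_) (∩-! F S j)) (absorb (S ! j) (F ! j))) odd
        where
        absorb : ∀ a b → a ∧ (b ∧ a) ≡ b ∧ a
        absorb true b = refl
        absorb false b = sym (∧-zeroʳ b)
      vanishes : VanishesOn (C *ᵥ y) F
      vanishes i Fi with S ! i in Si
      ... | false = *ᵥ-outside y i Si y⊆S
      ... | true = trans (*ᵥ-inside y i Si) (cong₂ _xor_ S·y (trans (∩-! F S i) (cong₂ _∧_ Fi Si)))

  ∪-feasible : ∀ F → Feasible C F → isOdd ∣ S ∣ ≡ false → Feasible C (F ∪ S)
  ∪-feasible F fF even = kernel-trivial⇒Feasible {C = C} {F ∪ S} trivial
    where
    trivial : ∀ y → InKernel C (F ∪ S) y → IsZero y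
    trivial y (y⊆ , vy) = Feasible⇒kernel-trivial {C = C} {F} fF y (y⊆F , VanishesOn-⊆ {v = C *ᵥ y} {F} {F ∪ S} F⊆F∪S vy)
      where
      F⊆F∪S : F ⊆ (F ∪ S)
      F⊆F∪S j Fj = trans (∪-! F S j) (cong (_∨ S ! j) Fj)
      -- on S the kernel equations say y is constant, equal to σ; summing over S (of even size) gives σ = 0
      y≡σ-on-S : ∀ i → S ! i ≡ true → y ! i ≡ S · (y !_)
      y≡σ-on-S i Si = sym (xor≡false⇒≡ (trans (sym (*ᵥ-inside y i Si))
        (vy i (trans (∪-! F S i) (trans (cong (F ! i ∨_) Si) (∨-zeroʳ (F ! i)))))))
      σ≡false : S · (y !_) ≡ false
      σ≡false = begin
        S · (y !_)                        ≡⟨ xorSum-cong constant ⟩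
        xorSum (λ j → S · (y !_) ∧ S ! j) ≡⟨ xorSum-∧ˡ (S · (y !_)) (S !_) ⟩
        S · (y !_) ∧ xorSum (S !_)        ≡⟨ cong (S · (y !_) ∧_) (trans (sym (isOdd-∣∣ S)) even) ⟩
        S · (y !_) ∧ false                ≡⟨ ∧-zeroʳ _ ⟩
        false ∎
        where
        open ≡-Reasoning
        constant : ∀ j → (S ! j ∧ y ! j) ≡ (S · (y !_) ∧ S ! j)
        constant j with S ! j in Sj
        ... | true = trans (y≡σ-on-S j Sj) (sym (∧-identityʳ _))
        ... | false = sym (∧-zeroʳ _)
      y⊆F : y ⊆ F
      y⊆F j yj with ∨-true (trans (sym (∪-! F S j)) (y⊆ j yj))
      ... | inj₁ Fj = Fj
      ... | inj₂ Sj = ⊥-elim (true≢false (trans (sym yj) (trans (y≡σ-on-S j Sj) σ≡false)))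

length-∈ : ∀ {A : Set} {xs : List A} {x} → x ∈ₗ xs → 0 < length xs
length-∈ (here _) = s≤s z≤n
length-∈ (there _) = s≤s z≤n

monomial⇒width-constant : ∀ {n} (Fs : SetSystem n) → IsMonomial (twistPolyCoeff Fs) →
  ∀ A B → width (twist Fs A) ≡ width (twist Fs B)
monomial⇒width-constant {n} Fs (m , k , _ , vanishes) A B = trans (≡k A) (sym (≡k B))
  where
  ≡k : ∀ A → width (twist Fs A) ≡ k
  ≡k A with width (twist Fs A) ℕ.≟ k
  ... | yes wA≡k = wA≡k
  ... | no wA≢k = ⊥-elim (<⇒≢ (length-∈ A∈filter) (sym (vanishes (width (twist Fs A)) wA≢k)))
    where
    A∈filter : A ∈ₗ filter (λ B → width (twist Fs B) ℕ.≟ width (twist Fs A)) (allSubsets n)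
    A∈filter = ∈-filter⁺ (λ B → width (twist Fs B) ℕ.≟ width (twist Fs A)) (∈-allSubsets A) refl

width-constant⇒monomial : ∀ {n} (Fs : SetSystem n) k → (∀ A → width (twist Fs A) ≡ k) →
  IsMonomial (twistPolyCoeff Fs)
width-constant⇒monomial {n} Fs k ≡k = length (allSubsets n) , k , all-k , others-0
  where
  all-k : twistPolyCoeff Fs k ≡ length (allSubsets n)
  all-k = cong length (filter-all (λ A → width (twist Fs A) ℕ.≟ k) (All.tabulate {xs = allSubsets n} (λ {A} _ → ≡k A)))
  others-0 : ∀ j → ¬ j ≡ k → twistPolyCoeff Fs j ≡ 0
  others-0 j j≢k = cong length (filter-none (λ A → width (twist Fs A) ℕ.≟ j)
                                            (All.tabulate {xs = allSubsets n} (λ {A} _ wA≡j → j≢k (trans (sym wA≡j) (≡k A)))))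

-- Monomial twist polynomial ⇒ odd complete components

module Forward {n : ℕ} {C : Matrix n} (symC : Symmetric C) (evC : IsEven C)
               (monomial : IsMonomial (twistPolyCoeff (D C))) where

  open Even symC evC

  Maximum : Subset n → Set
  Maximum F = Feasible C F × ∣ F ∣ ≡ rank

  width≡rank : ∀ A → width (twist (D C) A) ≡ rank
  width≡rank A = trans (monomial⇒width-constant (D C) monomial A ⊥) width-⊥

  search-maximum : (P : Subset n → Set) → (∀ F → Dec (P F)) →
    (∃ λ F → Maximum F × P F) ⊎ (∀ F → Maximum F → ¬ P F)
  search-maximum P P? with any? (λ F → (∣ F ∣ ℕ.≟ rank) ×-dec P? F) (D C)
  ... | yes found with find found
  ...   | F , F∈D , ∣F∣≡rank , PF = inj₁ (F , (∈D⇒Feasible {C = C} F∈D , ∣F∣≡rank) , PF)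
  search-maximum P P? | no none = inj₂ λ F (fF , ∣F∣≡rank) PF → none (lose (Feasible⇒∈D {C = C} F fF) (∣F∣≡rank , PF))

  -- Twisting by an edge ab avoided by a maximum F would give width at least |ab Δ F| = rank + 2.
  maximum-meets-edge : ∀ F {a b} → C a b ≡ true → Maximum F → F ! a ≡ false → F ! b ≡ false → Data.Empty.⊥
  maximum-meets-edge F {a} {b} Cab (fF , ∣F∣≡rank) Fa Fb = 1+n≰n (begin
    suc rank                                       ≤⟨ m≤n⇒m≤1+n ≤-refl ⟩
    2 + rank                                       ≡⟨ cong (2 +_) (sym ∣F∣≡rank) ⟩
    2 + ∣ F ∣                                      ≡⟨ sym (∣pairΔ∣ a≢b F) ⟩
    ∣ P Δ F ∣ + 2 * (bit (F ! a) + bit (F ! b))   ≡⟨ cong₂ (λ p q → ∣ P Δ F ∣ + 2 * (bit p + bit q)) Fa Fb ⟩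
    ∣ P Δ F ∣ + 0                                  ≡⟨ +-identityʳ _ ⟩
    ∣ P Δ F ∣                                      ≤⟨ ≤maxTwist P F fF ⟩
    maxTwist P                                     ≡⟨ sym (cong (maxTwist P ∸_) (Feasible⇒minTwist≡0 P (adjacent-pair-feasible Cab))) ⟩
    width (twist (D C) P)                          ≡⟨ width≡rank P ⟩
    rank ∎)
    where
    open Data.Nat.Properties.≤-Reasoning
    P = pair a b
    a≢b = adjacent⇒≢ Cab

  -- Otherwise twisting by {v} would give width below rank.
  avoided-by-maximum : ∀ v → ∃ λ F → Maximum F × F ! v ≡ false
  avoided-by-maximum v with search-maximum (λ F → F ! v ≡ false) (λ F → F ! v Data.Bool.≟ false)
  ... | inj₁ found = found
  ... | inj₂ none = ⊥-elim (<⇒≱ maxTwist<rank (subst (_≤ maxTwist S) (width≡rank S) (m∸n≤m (maxTwist S) (minTwist S))))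
    where
    S = singleton v
    bound : ∀ F → Feasible C F → suc ∣ S Δ F ∣ ≤ rank
    bound F fF with F ! v in Fv
    ... | true = subst (_≤ rank) (sym (∣singletonΔ∣-∈ {v = v} {F} Fv)) (Feasible⇒≤rank F fF)
    ... | false = subst (_≤ rank) (cong suc (sym (∣singletonΔ∣-∉ {v = v} {F} Fv)))
                        (non-maximum-gap F fF (λ maxF → none F (fF , maxF) Fv))
    maxTwist<rank : maxTwist S < rank
    maxTwist<rank with maxTwist-attained S
    ... | F , fF , eF = subst (λ m → suc m ≤ rank) eF (bound F fF)

  -- Otherwise twisting by the non-edge {a, b} would give width at most rank - 2, forcing rank = 0.
  maximum-avoids-non-edge : ∀ {a b} → ¬ a ≡ b → C a b ≡ false →
    ∃ λ F → Maximum F × F ! a ≡ false × F ! b ≡ false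
  maximum-avoids-non-edge {a} {b} a≢b Cab
    with search-maximum (λ F → F ! a ≡ false × F ! b ≡ false)
                        (λ F → (F ! a Data.Bool.≟ false) ×-dec (F ! b Data.Bool.≟ false))
  ... | inj₁ found = found
  ... | inj₂ none = ⊥-elim (none ⊥ (⊥-feasible , trans (∣⊥∣≡0 n) (sym rank≡0)) (⊥-! a , ⊥-! b))
    where
    P = pair a b

    upper : ∀ F → Feasible C F → ∣ P Δ F ∣ ≤ rank
    upper F fF with F ! a in Fa | F ! b in Fb | ∣pairΔ∣ a≢b F
    ... | false | false | e = subst (_≤ rank) (sym (trans (sym (+-identityʳ _)) e))
                                    (non-maximum-gap F fF (λ maxF → none F (fF , maxF) (Fa , Fb)))
    ... | true | x | e = ≤-trans (+2*suc⇒≤ _ _ (bit x) e) (Feasible⇒≤rank F fF)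
    ... | false | true | e = ≤-trans (+2*suc⇒≤ _ _ 0 e) (Feasible⇒≤rank F fF)

    lower : ∀ F → Feasible C F → 2 ≤ ∣ P Δ F ∣
    lower F fF = isOdd-+2 0 ∣ P Δ F ∣ (sym even) (nonzero)
      where
      even : isOdd ∣ P Δ F ∣ ≡ false
      even = trans (isOdd-∣Δ∣ P F) (cong₂ _xor_ (cong isOdd (∣pair∣ a≢b)) (feasible-even F fF))
      nonzero : 0 < ∣ P Δ F ∣
      nonzero with ∣ P Δ F ∣ in e
      ... | zero = ⊥-elim (non-adjacent-pair-infeasible Cab (subst (Feasible C) (sym (∣Δ∣≡0⇒≡ P F e)) fF))
      ... | suc _ = s≤s z≤n

    rank≡0 : rank ≡ 0
    rank≡0 = n≤n∸2⇒n≡0 rank (subst (_≤ rank ∸ 2) (width≡rank P)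
                               (∸-mono (maxTwist-lub P rank upper) (minTwist-glb P 2 lower)))

  exchange-out : ∀ F {b} → Maximum F → F ! b ≡ true →
    ∃ λ e → F ! e ≡ false × Maximum (insert (remove F b) e)
  exchange-out F {b} (fF , ∣F∣≡rank) Fb with avoided-by-maximum b
  ... | F′ , (fF′ , ∣F′∣≡rank) , F′b with kernel-vector F′ fF′ F′b
  ... | y , ky , yb
    with exchange-partner F fF Fb y (λ i _ → kernel-vector-global F′ y fF′ ∣F′∣≡rank F′b ky yb i) yb
  ... | e , Fe , z , kz , ze , zb =
    e , Fe , exchange F z fF Fe Fb kz ze zb , trans (∣insert-remove∣ F Fe Fb) ∣F∣≡rank

  -- If a ~ b ~ c but a ≁ c, exchanging b out of a maximum set avoiding a and c yields a maximum set
  -- avoiding b and one of a, c.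
  adjacency-transitive : ∀ {a b c} → C a b ≡ true → C b c ≡ true → ¬ a ≡ c → C a c ≡ true
  adjacency-transitive {a} {b} {c} Cab Cbc a≢c = ¬-not λ Cac → contradiction (maximum-avoids-non-edge a≢c Cac)
    where
    contradiction : (∃ λ F → Maximum F × F ! a ≡ false × F ! c ≡ false) → Data.Empty.⊥
    contradiction (F , maxF , Fa , Fc) = exchanged (exchange-out F maxF Fb)
      where
      Fb : F ! b ≡ true
      Fb = ¬-not (maximum-meets-edge F Cab maxF Fa)
      exchanged : (∃ λ e → F ! e ≡ false × Maximum (insert (remove F b) e)) → Data.Empty.⊥
      exchanged (e , Fe , maxG) = avoids-edge (e ≟ a) (e ≟ c)
        where
        G = insert (remove F b) e
        Gb : G ! b ≡ false
        Gb = ∉-insert (remove F b) (λ b≡e → true≢false (trans (sym Fb) (trans (cong (F !_) b≡e) Fe))) (remove-∌ F b)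
        G-avoids : ∀ {x} → F ! x ≡ false → ¬ x ≡ e → G ! x ≡ false
        G-avoids Fx x≢e = ∉-insert (remove F b) x≢e (∉-remove F b Fx)
        avoids-edge : Dec (e ≡ a) → Dec (e ≡ c) → Data.Empty.⊥
        avoids-edge (no e≢a) _ = maximum-meets-edge G Cab maxG (G-avoids Fa (e≢a ∘ sym)) Gb
        avoids-edge (yes _) (no e≢c) = maximum-meets-edge G Cbc maxG Gb (G-avoids Fc (e≢c ∘ sym))
        avoids-edge (yes e≡a) (yes e≡c) = a≢c (trans (sym e≡a) e≡c)

  N : Fin n → Subset n
  N v = tabulate (λ u → (u == v) ∨ C v u)

  N-∋ : ∀ v → N v ! v ≡ true
  N-∋ v = trans (tabulate-! _ v) (cong (_∨ C v v) (==-refl v))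

  N-adj : ∀ {v u} → C v u ≡ true → N v ! u ≡ true
  N-adj {v} {u} Cvu = trans (tabulate-! _ u) (trans (cong ((u == v) ∨_) Cvu) (∨-zeroʳ (u == v)))

  N-⊎ : ∀ {v u} → N v ! u ≡ true → u ≡ v ⊎ C v u ≡ true
  N-⊎ {v} {u} e with ∨-true (trans (sym (tabulate-! _ u)) e)
  ... | inj₁ u==v = inj₁ (==⇒≡ u==v)
  ... | inj₂ Cvu = inj₂ Cvu

  N-clique : ∀ {v a b} → N v ! a ≡ true → N v ! b ≡ true → ¬ a ≡ b → C a b ≡ true
  N-clique {v} {a} {b} Na Nb a≢b with N-⊎ Na | N-⊎ Nb
  ... | inj₁ refl | inj₁ refl = ⊥-elim (a≢b refl)
  ... | inj₁ refl | inj₂ Cvb = Cvb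
  ... | inj₂ Cva | inj₁ refl = trans (symC a v) Cva
  ... | inj₂ Cva | inj₂ Cvb = adjacency-transitive (trans (symC a v) Cva) Cvb a≢b

  N-closed : ∀ {v i j} → N v ! i ≡ true → C i j ≡ true → N v ! j ≡ true
  N-closed {v} {i} {j} Ni Cij with N-⊎ Ni | j ≟ v
  ... | inj₁ refl | _ = N-adj Cij
  ... | inj₂ _ | yes refl = N-∋ j
  ... | inj₂ Cvi | no j≢v = N-adj (adjacency-transitive Cvi Cij (j≢v ∘ sym))

  N-component : ∀ v → IsCliqueComponent C (N v)
  N-component v = closed-complete⇒clique-component (N v) N-closed N-clique

  -- If N v were even, adding it to a maximum feasible set avoiding v would stay feasible and grow by at least 2.
  N-odd : ∀ v → isOdd ∣ N v ∣ ≡ true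
  N-odd v = ¬-not λ even → too-large even (avoided-by-maximum v)
    where
    open CliqueComponent symC {N v} (N-component v)
    too-large : isOdd ∣ N v ∣ ≡ false → (∃ λ F → Maximum F × F ! v ≡ false) → Data.Empty.⊥
    too-large even (F , (fF , ∣F∣≡rank) , Fv) =
      <⇒≱ grows (Feasible⇒≤rank (F ∪ N v) (∪-feasible F fF even))
      where
      proper : ∣ F ∩ N v ∣ < ∣ N v ∣
      proper = p⊂q⇒∣p∣<∣q∣ (p∩q⊆q F (N v) , v , lookup⇒[]= v (N v) (N-∋ v) ,
                             λ v∈F∩N → true≢false (trans (sym ([]=⇒lookup (p∩q⊆p F (N v) v∈F∩N))) Fv))
      gap : 2 + ∣ F ∩ N v ∣ ≤ ∣ N v ∣
      gap = isOdd-+2 _ _ (trans (feasible-meets-evenly F fF) (sym even)) proper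
      grows : rank < ∣ F ∪ N v ∣
      grows = +-cancelʳ-≤ (∣ F ∩ N v ∣) (suc rank) (∣ F ∪ N v ∣) (begin
        suc rank + ∣ F ∩ N v ∣        ≤⟨ +-monoˡ-≤ ∣ F ∩ N v ∣ (n≤1+n (suc rank)) ⟩
        2 + rank + ∣ F ∩ N v ∣        ≡⟨ cong suc (cong suc (+-comm rank ∣ F ∩ N v ∣)) ⟩
        2 + ∣ F ∩ N v ∣ + rank        ≤⟨ +-monoˡ-≤ rank gap ⟩
        ∣ N v ∣ + rank                ≡⟨ +-comm ∣ N v ∣ rank ⟩
        rank + ∣ N v ∣                ≡⟨ cong (_+ ∣ N v ∣) (sym ∣F∣≡rank) ⟩
        ∣ F ∣ + ∣ N v ∣               ≡⟨ sym (∣∪∣+∣∩∣ F (N v)) ⟩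
        ∣ F ∪ N v ∣ + ∣ F ∩ N v ∣ ∎)
        where open Data.Nat.Properties.≤-Reasoning

  Connected⇒N : ∀ {v u} → Connected C v u → N v ! u ≡ true
  Connected⇒N {v} here = N-∋ v
  Connected⇒N (step c (_ , Cwu)) = N-closed (Connected⇒N c) Cwu

  N⇒Connected : ∀ {v u} → N v ! u ≡ true → Connected C v u
  N⇒Connected Nu with N-⊎ Nu
  ... | inj₁ refl = here
  ... | inj₂ Cvu = step here (adjacent⇒≢ Cvu , Cvu)

  components-odd-complete : ComponentsOddComplete C
  components-odd-complete v =
    N v ,
    (λ u → mk⇔ (λ u∈N → N⇒Connected ([]=⇒lookup u∈N)) (λ c → lookup⇒[]= u (N v) (Connected⇒N c))) ,
    isOdd⇒%2≡1 ∣ N v ∣ (N-odd v) ,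
    (λ a b a∈N b∈N a≢b → a≢b , N-clique ([]=⇒lookup a∈N) ([]=⇒lookup b∈N) a≢b)

-- Odd complete components ⇒ monomial twist polynomial

Connected-trans : ∀ {n} {C : Matrix n} {a b c} → Connected C a b → Connected C b c → Connected C a c
Connected-trans ab here = ab
Connected-trans ab (step bc adj) = step (Connected-trans ab bc) adj

Connected-sym : ∀ {n} {C : Matrix n} → Symmetric C → ∀ {a b} → Connected C a b → Connected C b a
Connected-sym symC here = here
Connected-sym symC (step {w} {u} c (w≢u , Cwu)) =
  Connected-trans (step here ((w≢u ∘ sym) , trans (symC u w) Cwu)) (Connected-sym symC c)

module Backward {n : ℕ} {C : Matrix n} (symC : Symmetric C) (evC : IsEven C)
                (odd-complete : ComponentsOddComplete C) where

  open Even symC evC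

  S : Fin n → Subset n
  S v = proj₁ (odd-complete v)

  S⇒Connected : ∀ {v u} → S v ! u ≡ true → Connected C v u
  S⇒Connected {v} {u} e = Equivalence.to (proj₁ (proj₂ (odd-complete v)) u) (lookup⇒[]= u (S v) e)

  Connected⇒S : ∀ {v u} → Connected C v u → S v ! u ≡ true
  Connected⇒S {v} {u} c = []=⇒lookup (Equivalence.from (proj₁ (proj₂ (odd-complete v)) u) c)

  S-∋ : ∀ v → S v ! v ≡ true
  S-∋ v = Connected⇒S here

  S-odd : ∀ v → isOdd ∣ S v ∣ ≡ true
  S-odd v = %2≡1⇒isOdd ∣ S v ∣ (proj₁ (proj₂ (proj₂ (odd-complete v))))

  S-complete : ∀ {v a b} → S v ! a ≡ true → S v ! b ≡ true → ¬ a ≡ b → C a b ≡ true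
  S-complete {v} {a} {b} Sa Sb a≢b =
    proj₂ (proj₂ (proj₂ (proj₂ (odd-complete v))) a b (lookup⇒[]= a (S v) Sa) (lookup⇒[]= b (S v) Sb) a≢b)

  S-same : ∀ {v x} → S v ! x ≡ true → ∀ u → S x ! u ≡ S v ! u
  S-same {v} {x} Sx u = bool-ext
    (λ Sxu → Connected⇒S (Connected-trans (S⇒Connected Sx) (S⇒Connected Sxu)))
    (λ Svu → Connected⇒S (Connected-trans (Connected-sym symC (S⇒Connected Sx)) (S⇒Connected Svu)))

  S-component : ∀ v → IsCliqueComponent C (S v)
  S-component v = closed-complete⇒clique-component (S v)
    (λ Si Cij → Connected⇒S (step (S⇒Connected Si) (adjacent⇒≢ Cij , Cij))) S-complete

  feasible-meets-components-evenly : ∀ F → Feasible C F → ∀ v → isOdd ∣ F ∩ S v ∣ ≡ false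
  feasible-meets-components-evenly F fF v = CliqueComponent.feasible-meets-evenly symC {S v} (S-component v) F fF

  -- A kernel vector y of C[F] is constant, say σ, on each component, and σ vanishes since F meets it evenly.
  meets-components-evenly⇒feasible : ∀ F → (∀ v → isOdd ∣ F ∩ S v ∣ ≡ false) → Feasible C F
  meets-components-evenly⇒feasible F even = kernel-trivial⇒Feasible {C = C} {F} trivial
    where
    trivial : ∀ y → InKernel C F y → IsZero y
    trivial y (y⊆F , vy) = zero-everywhere
      where
      σ : Fin n → Bool
      σ i = S i · (y !_)
      zero-outside : ∀ {j} → F ! j ≡ false → y ! j ≡ false
      zero-outside {j} Fj = ¬-not λ yj → true≢false (trans (sym (y⊆F j yj)) Fj)
      y≡σ : ∀ i → F ! i ≡ true → y ! i ≡ σ i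
      y≡σ i Fi = sym (xor≡false⇒≡ (trans (sym (CliqueComponent.*ᵥ-inside symC {S i} (S-component i) y i (S-∋ i))) (vy i Fi)))
      σ-same : ∀ i j → S i ! j ≡ true → σ j ≡ σ i
      σ-same i j Sij = xorSum-cong λ u → cong (_∧ y ! u) (S-same Sij u)
      σ≡false : ∀ i → σ i ≡ false
      σ≡false i = begin
        σ i                                        ≡⟨ xorSum-cong on-component ⟩
        xorSum (λ j → σ i ∧ (F ! j ∧ S i ! j))     ≡⟨ xorSum-∧ˡ (σ i) (λ j → F ! j ∧ S i ! j) ⟩
        σ i ∧ F · (S i !_)                         ≡⟨ cong (σ i ∧_) (trans (sym (isOdd-∣∩∣ F (S i))) (even i)) ⟩
        σ i ∧ false                                ≡⟨ ∧-zeroʳ (σ i) ⟩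
        false ∎
        where
        open ≡-Reasoning
        on-component : ∀ j → (S i ! j ∧ y ! j) ≡ (σ i ∧ (F ! j ∧ S i ! j))
        on-component j with S i ! j in Sij | F ! j in Fj
        ... | false | f = sym (trans (cong (σ i ∧_) (∧-zeroʳ f)) (∧-zeroʳ (σ i)))
        ... | true | true = trans (y≡σ j Fj) (trans (σ-same i j Sij) (sym (∧-identityʳ (σ i))))
        ... | true | false = trans (zero-outside Fj) (sym (∧-zeroʳ (σ i)))
      zero-everywhere : IsZero y
      zero-everywhere j with F ! j in Fj
      ... | true = trans (y≡σ j Fj) (σ≡false j)
      ... | false = zero-outside Fj

  flip-feasible : ∀ F {x y} → Feasible C F → ¬ x ≡ y → S x ! y ≡ true → Feasible C (F Δ pair x y)
  flip-feasible F {x} {y} fF x≢y Sxy = meets-components-evenly⇒feasible (F Δ pair x y) λ v → begin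
    isOdd ∣ (F Δ pair x y) ∩ S v ∣                       ≡⟨ isOdd-∣Δ∩∣ F (pair x y) (S v) ⟩
    isOdd ∣ F ∩ S v ∣ xor isOdd ∣ pair x y ∩ S v ∣
      ≡⟨ cong₂ _xor_ (feasible-meets-components-evenly F fF v) (cong isOdd (∣pair∩∣ x≢y (S v))) ⟩
    false xor isOdd (bit (S v ! x) + bit (S v ! y))     ≡⟨ cong (λ b → isOdd (bit b + bit (S v ! y))) (same v) ⟩
    isOdd (bit (S v ! y) + bit (S v ! y))               ≡⟨ isOdd-double (S v ! y) ⟩
    false ∎
    where
    open ≡-Reasoning
    same : ∀ v → S v ! x ≡ S v ! y
    same v = bool-ext
      (λ Svx → Connected⇒S (Connected-trans (S⇒Connected Svx) (S⇒Connected Sxy)))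
      (λ Svy → Connected⇒S (Connected-trans (S⇒Connected Svy) (Connected-sym symC (S⇒Connected Sxy))))
    isOdd-double : ∀ b → isOdd (bit b + bit b) ≡ false
    isOdd-double true = refl
    isOdd-double false = refl

  -- Twisting additionally by x shifts both extremal sizes up by one when A meets the component of x
  -- evenly; the parity argument supplies a partner y of x in that component to flip together with x.
  module TwistStep (A : Subset n) (x : Fin n) (even : isOdd ∣ A ∩ S x ∣ ≡ false) where

    A′ : Subset n
    A′ = singleton x Δ A

    A′Δ : ∀ F → A′ Δ F ≡ singleton x Δ (A Δ F)
    A′Δ F = Δ-assoc (singleton x) A F

    ΔFlip : ∀ F P → A Δ (F Δ P) ≡ P Δ (A Δ F)
    ΔFlip F P = trans (sym (Δ-assoc A F P)) (Δ-comm (A Δ F) P)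

    ∣A′Δ∣≤ : ∀ F → ∣ A′ Δ F ∣ ≤ suc ∣ A Δ F ∣
    ∣A′Δ∣≤ F = subst (λ X → ∣ X ∣ ≤ suc ∣ A Δ F ∣) (sym (A′Δ F)) (∣singletonΔ∣≤ x (A Δ F))

    even-on-component : ∀ F → Feasible C F → isOdd ∣ (A Δ F) ∩ S x ∣ ≡ false
    even-on-component F fF =
      trans (isOdd-∣Δ∩∣ A F (S x)) (cong₂ _xor_ even (feasible-meets-components-evenly F fF x))

    partner-outside : ∀ F → Feasible C F → ∃ λ y → S x ! y ≡ true × (A Δ F) ! y ≡ false
    partner-outside F fF with xorSum-true (λ j → S x ! j ∧ not ((A Δ F) ! j)) odd-remainder
      where
      odd-remainder : xorSum (λ j → S x ! j ∧ not ((A Δ F) ! j)) ≡ true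
      odd-remainder = begin
        xorSum (λ j → S x ! j ∧ not ((A Δ F) ! j))
          ≡⟨ xorSum-cong (λ j → complement (S x ! j) ((A Δ F) ! j)) ⟩
        xorSum (λ j → S x ! j xor ((A Δ F) ! j ∧ S x ! j))
          ≡⟨ xorSum-xor (S x !_) (λ j → (A Δ F) ! j ∧ S x ! j) ⟩
        xorSum (S x !_) xor (A Δ F) · (S x !_)
          ≡⟨ cong₂ _xor_ (trans (sym (isOdd-∣∣ (S x))) (S-odd x))
                         (trans (sym (isOdd-∣∩∣ (A Δ F) (S x))) (even-on-component F fF)) ⟩
        true ∎
        where
        open ≡-Reasoning
        complement : ∀ s t → s ∧ not t ≡ s xor (t ∧ s)
        complement true true = refl
        complement true false = refl
        complement false t = sym (∧-zeroʳ t)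
    ... | y , e = y , ∧-conicalˡ _ _ e , not-injective (∧-conicalʳ _ _ e)

    partner-inside : ∀ F → Feasible C F → (A Δ F) ! x ≡ true →
      ∃ λ y → S x ! y ≡ true × (A Δ F) ! y ≡ true × ¬ x ≡ y
    partner-inside F fF x∈ with xorSum-true (λ j → ((A Δ F) ! j ∧ S x ! j) ∧ not (j == x)) odd-remainder
      where
      odd-remainder : xorSum (λ j → ((A Δ F) ! j ∧ S x ! j) ∧ not (j == x)) ≡ true
      odd-remainder = begin
        rest                                  ≡⟨ sym (xor-cancelʳ rest ((A Δ F) ! x ∧ S x ! x)) ⟩
        (rest xor ((A Δ F) ! x ∧ S x ! x)) xor ((A Δ F) ! x ∧ S x ! x)
          ≡⟨ cong₂ _xor_ (sym (xorSum-remove (λ j → (A Δ F) ! j ∧ S x ! j) x)) (cong₂ _∧_ x∈ (S-∋ x)) ⟩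
        (A Δ F) · (S x !_) xor true           ≡⟨ cong (_xor true) (trans (sym (isOdd-∣∩∣ (A Δ F) (S x))) (even-on-component F fF)) ⟩
        true ∎
        where
        open ≡-Reasoning
        rest = xorSum (λ j → ((A Δ F) ! j ∧ S x ! j) ∧ not (j == x))
    ... | y , e = y , ∧-conicalʳ ((A Δ F) ! y) _ y∈ , ∧-conicalˡ _ (S x ! y) y∈ ,
                  λ x≡y → true≢false (trans (sym (∧-conicalʳ _ _ e)) (cong not (trans (cong (_== x) (sym x≡y)) (==-refl x))))
      where
      y∈ : (A Δ F) ! y ∧ S x ! y ≡ true
      y∈ = ∧-conicalˡ _ (not (y == x)) e

    raise : ∀ F → Feasible C F → ∃ λ F′ → Feasible C F′ × ∣ A′ Δ F′ ∣ ≡ suc ∣ A Δ F ∣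
    raise F fF with (A Δ F) ! x in x∈
    ... | false = F , fF , trans (cong ∣_∣ (A′Δ F)) (∣singletonΔ∣-∉ {v = x} {A Δ F} x∈)
    ... | true with partner-outside F fF
    ...   | y , Sxy , y∉ = F Δ P , flip-feasible F fF x≢y Sxy , (begin
      ∣ A′ Δ (F Δ P) ∣                    ≡⟨ cong ∣_∣ (A′Δ (F Δ P)) ⟩
      ∣ singleton x Δ (A Δ (F Δ P)) ∣     ≡⟨ ∣singletonΔ∣-∉ {v = x} {A Δ (F Δ P)} x∉ ⟩
      suc ∣ A Δ (F Δ P) ∣                 ≡⟨ cong (λ X → suc ∣ X ∣) (ΔFlip F P) ⟩
      suc ∣ P Δ (A Δ F) ∣                 ≡⟨ cong suc (∣pairΔ∣-swap x≢y {A Δ F} x∈ y∉) ⟩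
      suc ∣ A Δ F ∣ ∎)
      where
      open ≡-Reasoning
      P = pair x y
      x≢y : ¬ x ≡ y
      x≢y x≡y = true≢false (trans (sym x∈) (trans (cong ((A Δ F) !_) x≡y) y∉))
      x∉ : (A Δ (F Δ P)) ! x ≡ false
      x∉ = trans (cong (_! x) (ΔFlip F P)) (trans (Δ-! P (A Δ F) x) (cong₂ _xor_ (pair-∋ˡ x y) x∈))

    lower-bound : ∀ F → Feasible C F → suc (minTwist A) ≤ ∣ A′ Δ F ∣
    lower-bound F fF with (A Δ F) ! x in x∈
    ... | false = subst (suc (minTwist A) ≤_) (sym (trans (cong ∣_∣ (A′Δ F)) (∣singletonΔ∣-∉ {v = x} {A Δ F} x∈)))
                        (s≤s (minTwist≤ A F fF))
    ... | true with partner-inside F fF x∈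
    ...   | y , Sxy , y∈ , x≢y = ≤-pred (begin
      2 + minTwist A                      ≤⟨ s≤s (s≤s (minTwist≤ A (F Δ P) (flip-feasible F fF x≢y Sxy))) ⟩
      2 + ∣ A Δ (F Δ P) ∣                 ≡⟨ cong (λ X → 2 + ∣ X ∣) (ΔFlip F P) ⟩
      2 + ∣ P Δ (A Δ F) ∣                 ≡⟨ ∣pairΔ∣-both x≢y {A Δ F} x∈ y∈ ⟩
      ∣ A Δ F ∣                           ≡⟨ sym (∣singletonΔ∣-∈ {v = x} {A Δ F} x∈) ⟩
      suc ∣ singleton x Δ (A Δ F) ∣       ≡⟨ cong (λ X → suc ∣ X ∣) (sym (A′Δ F)) ⟩
      suc ∣ A′ Δ F ∣ ∎)
      where
      open Data.Nat.Properties.≤-Reasoning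
      P = pair x y

    maxTwist-step : maxTwist A′ ≡ suc (maxTwist A)
    maxTwist-step = ≤-antisym
      (maxTwist-lub A′ (suc (maxTwist A)) λ F fF → ≤-trans (∣A′Δ∣≤ F) (s≤s (≤maxTwist A F fF)))
      (reach (maxTwist-attained A))
      where
      reach : (∃ λ F → Feasible C F × ∣ A Δ F ∣ ≡ maxTwist A) → suc (maxTwist A) ≤ maxTwist A′
      reach (F , fF , eF) with raise F fF
      ... | F′ , fF′ , e = subst (_≤ maxTwist A′) (trans e (cong suc eF)) (≤maxTwist A′ F′ fF′)

    minTwist-step : minTwist A′ ≡ suc (minTwist A)
    minTwist-step = ≤-antisym (reach (minTwist-attained A)) (minTwist-glb A′ (suc (minTwist A)) lower-bound)
      where
      reach : (∃ λ F → Feasible C F × ∣ A Δ F ∣ ≡ minTwist A) → minTwist A′ ≤ suc (minTwist A)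
      reach (F , fF , eF) = ≤-trans (minTwist≤ A′ F fF) (subst (λ m → ∣ A′ Δ F ∣ ≤ suc m) eF (∣A′Δ∣≤ F))

  width-twist-singleton : ∀ A x → width (twist (D C) (singleton x Δ A)) ≡ width (twist (D C) A)
  width-twist-singleton A x with isOdd ∣ A ∩ S x ∣ in parity
  ... | false = cong₂ _∸_ maxTwist-step minTwist-step
    where open TwistStep A x parity
  ... | true = sym (subst (λ B → width (twist (D C) B) ≡ width (twist (D C) (singleton x Δ A)))
                          (Δ-cancelˡ (singleton x) A)
                          (cong₂ _∸_ maxTwist-step minTwist-step))
    where
    flipped : isOdd ∣ (singleton x Δ A) ∩ S x ∣ ≡ false
    flipped = trans (isOdd-∣Δ∩∣ (singleton x) A (S x))
                    (cong₂ _xor_ (cong isOdd (trans (∣singleton∩∣ x (S x)) (cong bit (S-∋ x)))) parity)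
    open TwistStep (singleton x Δ A) x flipped

  width≡width-⊥ : ∀ A → width (twist (D C) A) ≡ width (twist (D C) ⊥)
  width≡width-⊥ A = by-size ∣ A ∣ A refl
    where
    by-size : ∀ k A → ∣ A ∣ ≡ k → width (twist (D C) A) ≡ width (twist (D C) ⊥)
    by-size zero A ∣A∣≡0 = cong (λ B → width (twist (D C) B)) (∣∣≡0⇒≡⊥ A ∣A∣≡0)
    by-size (suc k) A ∣A∣≡1+k
      with count>0⇒true (A !_) (subst (0 <_) (trans (sym ∣A∣≡1+k) (∣∣≡count A)) (s≤s z≤n))
    ... | x , Ax = begin
      width (twist (D C) A)                       ≡⟨ cong (λ B → width (twist (D C) B)) (sym (Δ-cancelˡ (singleton x) A)) ⟩
      width (twist (D C) (singleton x Δ A₀))      ≡⟨ width-twist-singleton A₀ x ⟩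
      width (twist (D C) A₀)
        ≡⟨ by-size k A₀ (suc-injective (trans (∣singletonΔ∣-∈ {v = x} {A} Ax) ∣A∣≡1+k)) ⟩
      width (twist (D C) ⊥) ∎
      where
      open ≡-Reasoning
      A₀ = singleton x Δ A

  monomial : IsMonomial (twistPolyCoeff (D C))
  monomial = width-constant⇒monomial (D C) (width (twist (D C) ⊥)) width≡width-⊥

corollary1 : {n : ℕ} (C : Matrix n) → Symmetric C → IsEven C →
    (IsMonomial (twistPolyCoeff (D C)) ⇔ ComponentsOddComplete C)
corollary1 C symC evC =
  mk⇔ (λ mono → Forward.components-odd-complete symC evC mono)
      (λ odd-complete → Backward.monomial symC evC odd-complete)
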